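{- Let $n\ge1$ and let $D_n^*=\mathbb{Z}^n\cup\left(\mathbb{Z}^n+(\tfrac12,\dots,\tfrac12)\right)$ be the dual of $D_n=\{x\in\mathbb{Z}^n:\sum_ix_i\equiv0\pmod2\}$. There exist primitive vectors $\bm v_w\in\mathbb{Z}^{n+1}$, $w\in\mathbb{N}$, with $\|\bm v_w\|\to\infty$, such that, letting $\Lambda_w$ be the orthogonal projection of $\mathbb{Z}^{n+1}$ onto $\bm v_w^{\perp}$, there are Gram matrices $A_w$ of $\Lambda_w$, a Gram matrix $A$ of $D_n^*$, and real numbers $c_w$ with $$\|A-c_wA_w\|_\infty=O\!\left(\frac{1}{\|\bm v_w\|^{2/n}}\right)\quad\text{as } w\to\infty.$$
   Context: For a matrix $M$, $\|M\|_\infty=\max_{i,j}|M_{ij}|$; $\|\bm v\|$ is the Euclidean norm. A vector of $\mathbb{Z}^{n+1}$ is primitive if the gcd of its entries is $1$. -}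

module Defs where

open import Data.Nat as ℕ using (ℕ; zero; suc)
open import Data.Integer as ℤ using (ℤ; +_)
open import Data.Integer.GCD using () renaming (gcd to gcdℤ)
open import Data.Rational as ℚ using (ℚ; 0ℚ; 1ℚ; ½; _+_; _*_; _-_)
open import Data.Fin using (Fin; zero; suc)
open import Data.Product using (Σ; ∃; _×_; _,_)
open import Data.Sum using (_⊎_)
open import Relation.Binary.PropositionalEquality using (_≡_)

Vecℚ : ℕ → Set
Vecℚ k = Fin k → ℚ

sumℚ : ∀ {k} → (Fin k → ℚ) → ℚ
sumℚ {zero}  f = 0ℚ
sumℚ {suc k} f = f zero + sumℚ (λ i → f (suc i))

sumℤ : ∀ {k} → (Fin k → ℤ) → ℤ
sumℤ {zero}  f = + 0
sumℤ {suc k} f = f zero ℤ.+ sumℤ (λ i → f (suc i))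

-- gcd of all entries of an integer vector (gcd of the empty vector is 0).
gcdVec : ∀ {k} → (Fin k → ℤ) → ℤ
gcdVec {zero}  f = + 0
gcdVec {suc k} f = gcdℤ (f zero) (gcdVec (λ i → f (suc i)))

Primitive : ∀ {k} → (Fin k → ℤ) → Set
Primitive v = gcdVec v ≡ + 1

normSqℤ : ∀ {k} → (Fin k → ℤ) → ℤ
normSqℤ v = sumℤ (λ i → v i ℤ.* v i)

dot : ∀ {k} → Vecℚ k → Vecℚ k → ℚ
dot x y = sumℚ (λ i → x i * y i)

toℚ : ∀ {k} → (Fin k → ℤ) → Vecℚ k
toℚ v i = v i ℚ./ 1

IsInt : ℚ → Set
IsInt q = ∃ λ (z : ℤ) → q ≡ z ℚ./ 1

powℚ : ℚ → ℕ → ℚ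
powℚ q zero    = 1ℚ
powℚ q (suc m) = q * powℚ q m

Lattice : ℕ → Set₁
Lattice k = Vecℚ k → Set

-- Orthogonal projection of ℤ^(k) onto v^⊥ (v ≠ 0):
-- y is the projection of x iff y ⊥ v and x - y ∈ ℚ v
-- (this is the defining property of the orthogonal projection).
IsOrthProj : ∀ {k} → (Fin k → ℤ) → (Fin k → ℤ) → Vecℚ k → Set
IsOrthProj v x y =
  (dot y (toℚ v) ≡ 0ℚ) × (∃ λ (t : ℚ) → ∀ i → toℚ x i - y i ≡ t * toℚ v i)

ProjLattice : ∀ {k} → (Fin k → ℤ) → Lattice k
ProjLattice v y = ∃ λ (x : Fin _ → ℤ) → IsOrthProj v x y

DnDual : (n : ℕ) → Lattice n
DnDual n y = (∀ i → IsInt (y i)) ⊎ (∀ i → IsInt (y i - ½))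

lincomb : ∀ {r k} → (Fin r → ℚ) → (Fin r → Vecℚ k) → Vecℚ k
lincomb c b j = sumℚ (λ i → c i * b i j)

IsBasis : ∀ {r k} → Lattice k → (Fin r → Vecℚ k) → Set
IsBasis {r} {k} L b =
    (∀ i → L (b i))
  × (∀ (c : Fin r → ℚ) → (∀ j → lincomb c b j ≡ 0ℚ) → ∀ i → c i ≡ 0ℚ)
  × (∀ y → L y → ∃ λ (z : Fin r → ℤ) → ∀ j → y j ≡ lincomb (toℚ z) b j)

IsGramMatrix : ∀ {r k} → Lattice k → (Fin r → Fin r → ℚ) → Set
IsGramMatrix {r} {k} L A =
  ∃ λ (b : Fin r → Vecℚ k) → IsBasis L b × (∀ i j → A i j ≡ dot (b i) (b j))

module Submission where

-- Write n = r + 1 and, for every w, put k = 2w + 2, P = k + 1, Q = k - 1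
-- (coprime, by an explicit Bézout identity).  With V_j = P^(r-j) Q^j the
-- vector  v = (2(V_1 + ... + V_r) - 2k V_0, V_0, ..., V_r)  is primitive.
-- The integer vectors  f_0 = (1, 2k, -2, ..., -2)  and
-- f_(d+1) = P e_(d+2) - Q e_(d+1)  are orthogonal to v, and Bézout gives
-- integer vectors x_i with f_l · x_i = δ_li.  A vector orthogonal to v and to
-- every f_l vanishes, so the projections y_i of the x_i onto v^⊥ form a basis
-- of Λ_v, and the Gram matrix G of the y_i is inverse to H = (f_l · f_m).
-- Splitting f_m = k (0, b_m) + s_m, where (b_m) is the basis of D_n dual to
-- the basis (a_m) of D_n^*, gives H = k² M + R with M = Gram(b) = Gram(a)^-1
-- and R bounded.  A general perturbation lemma for inverse matrices turns
-- this into k² |A - k² G| = O(1) for A = Gram(a); together with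
-- ‖v‖² = O(k^(2n)) and ‖v‖² ≥ k this gives the theorem with c_w = k².

open import Defs
open import Data.Nat as ℕ using (ℕ; zero; suc; _≥_; _∸_)
import Data.Nat.Properties as ℕP
open import Data.Integer as ℤ using (ℤ; +_; _^_)
import Data.Integer.Properties as ℤP
open import Data.Rational as ℚ using (ℚ; 0ℚ; 1ℚ; ½; _+_; _*_; _-_; ∣_∣; _≤_; _<_; 1/_)
import Data.Rational.Properties as ℚP
import Data.Rational.Unnormalised as ℚᵘ
import Data.Rational.Unnormalised.Properties as ℚᵘP
open import Data.Fin as Fin using (Fin; zero; suc; toℕ; inject₁)
import Data.Fin.Properties as FinP
open import Data.Product using (Σ; ∃; ∃₂; _×_; _,_; proj₁; proj₂)
open import Data.Sum using (_⊎_; inj₁; inj₂)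
open import Data.Unit using (tt)
open import Data.Bool using (true; false; if_then_else_)
open import Data.Empty using (⊥-elim)
open import Relation.Nullary using (¬_; yes; no)
open import Relation.Nullary.Decidable using (dec-true; dec-false; T?)
open import Relation.Binary.Definitions using (tri<; tri≈; tri>)
import Data.Integer.Divisibility.Signed as ZDS
import Data.Integer.GCD as ZG
import Data.Nat.Divisibility as ℕD
open import Data.Integer.Divisibility using () renaming (_∣_ to _∣ᵤ_)
open import Relation.Binary.PropositionalEquality
import Data.Rational.Solver as ℚSolver
import Data.Integer.Solver as ℤSolver

module IntegerCast where

  ι : ℤ → ℚ
  ι z = z ℚ./ 1

  private
    ι-as-ℚᵘ : ∀ z → ℚ.toℚᵘ (ι z) ℚᵘ.≃ ℚᵘ.mkℚᵘ z 0
    ι-as-ℚᵘ z = ℚP.toℚᵘ-fromℚᵘ (ℚᵘ.mkℚᵘ z 0)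

  ι-+ : ∀ a b → ι (a ℤ.+ b) ≡ ι a + ι b
  ι-+ a b = ℚP.toℚᵘ-injective
    (ℚᵘP.≃-trans (ι-as-ℚᵘ (a ℤ.+ b))
    (ℚᵘP.≃-trans (ℚᵘ.*≡* cross)
    (ℚᵘP.≃-trans (ℚᵘP.+-cong (ℚᵘP.≃-sym (ι-as-ℚᵘ a)) (ℚᵘP.≃-sym (ι-as-ℚᵘ b)))
                 (ℚᵘP.≃-sym (ℚP.toℚᵘ-homo-+ (ι a) (ι b))))))
    where
    cross : (a ℤ.+ b) ℤ.* + 1 ≡ (a ℤ.* + 1 ℤ.+ b ℤ.* + 1) ℤ.* + 1
    cross rewrite ℤP.*-identityʳ (a ℤ.+ b) | ℤP.*-identityʳ a | ℤP.*-identityʳ b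
                | ℤP.*-identityʳ (a ℤ.+ b) = refl

  ι-* : ∀ a b → ι (a ℤ.* b) ≡ ι a * ι b
  ι-* a b = ℚP.toℚᵘ-injective
    (ℚᵘP.≃-trans (ι-as-ℚᵘ (a ℤ.* b))
    (ℚᵘP.≃-trans (ℚᵘ.*≡* refl)
    (ℚᵘP.≃-trans (ℚᵘP.*-cong (ℚᵘP.≃-sym (ι-as-ℚᵘ a)) (ℚᵘP.≃-sym (ι-as-ℚᵘ b)))
                 (ℚᵘP.≃-sym (ℚP.toℚᵘ-homo-* (ι a) (ι b))))))

  ι-neg : ∀ a → ι (ℤ.- a) ≡ ℚ.- ι a
  ι-neg a = ℚP.toℚᵘ-injective
    (ℚᵘP.≃-trans (ι-as-ℚᵘ (ℤ.- a))
    (ℚᵘP.≃-trans (ℚᵘP.-‿cong (ℚᵘP.≃-sym (ι-as-ℚᵘ a)))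
                 (ℚᵘP.≃-sym (ℚP.toℚᵘ-homo‿- (ι a)))))

  ι-- : ∀ a b → ι (a ℤ.- b) ≡ ι a - ι b
  ι-- a b = trans (ι-+ a (ℤ.- b)) (cong (λ t → ι a + t) (ι-neg b))

  ι-pow : ∀ x e → ι (x ^ e) ≡ powℚ (ι x) e
  ι-pow x zero    = refl
  ι-pow x (suc e) = trans (ι-* x (x ^ e)) (cong (ι x *_) (ι-pow x e))

  ι-mono : ∀ {a b} → a ℤ.≤ b → ι a ≤ ι b
  ι-mono {a} {b} h = ℚP.toℚᵘ-cancel-≤
    (ℚᵘP.≤-respˡ-≃ (ℚᵘP.≃-sym (ι-as-ℚᵘ a)) (ℚᵘP.≤-respʳ-≃ (ℚᵘP.≃-sym (ι-as-ℚᵘ b))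
       (ℚᵘ.*≤* (subst₂ ℤ._≤_ (sym (ℤP.*-identityʳ a)) (sym (ℤP.*-identityʳ b)) h))))

  ι-cancel-≤ : ∀ {a b} → ι a ≤ ι b → a ℤ.≤ b
  ι-cancel-≤ {a} {b} h
    with ℚᵘP.≤-respˡ-≃ (ι-as-ℚᵘ a) (ℚᵘP.≤-respʳ-≃ (ι-as-ℚᵘ b) (ℚP.toℚᵘ-mono-≤ h))
  ... | ℚᵘ.*≤* e = subst₂ ℤ._≤_ (ℤP.*-identityʳ a) (ℤP.*-identityʳ b) e

  ℕ→ℚ : ℕ → ℚ
  ℕ→ℚ m = ι (+ m)

  ℕ→ℚ≥0 : ∀ m → 0ℚ ≤ ℕ→ℚ m
  ℕ→ℚ≥0 m = ι-mono {+ 0} {+ m} (ℤ.+≤+ ℕ.z≤n)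

  ℕ→ℚ-mono : ∀ {a b} → a ℕ.≤ b → ℕ→ℚ a ≤ ℕ→ℚ b
  ℕ→ℚ-mono h = ι-mono (ℤ.+≤+ h)

  ℕ→ℚ-* : ∀ a b → ℕ→ℚ (a ℕ.* b) ≡ ℕ→ℚ a * ℕ→ℚ b
  ℕ→ℚ-* a b = trans (cong ι (ℤP.pos-* a b)) (ι-* (+ a) (+ b))

  ℕ→ℚ-suc : ∀ x → ℕ→ℚ (suc x) ≡ ℕ→ℚ x + 1ℚ
  ℕ→ℚ-suc x = trans (cong (λ t → ι (+ t)) (ℕP.+-comm 1 x))
                    (trans (cong ι (ℤP.pos-+ x 1)) (ι-+ (+ x) (+ 1)))

  two : ℚ
  two = ℕ→ℚ 2

open IntegerCast

module FiniteSums where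
  open ℚSolver.+-*-Solver

  sum-cong : ∀ {k} {f g : Fin k → ℚ} → (∀ i → f i ≡ g i) → sumℚ f ≡ sumℚ g
  sum-cong {zero}  e = refl
  sum-cong {suc k} e = cong₂ _+_ (e zero) (sum-cong (λ i → e (suc i)))

  sum-+ : ∀ {k} (f g : Fin k → ℚ) → sumℚ (λ i → f i + g i) ≡ sumℚ f + sumℚ g
  sum-+ {zero}  f g = refl
  sum-+ {suc k} f g =
    trans (cong (λ x → f zero + g zero + x) (sum-+ (λ i → f (suc i)) (λ i → g (suc i))))
          (solve 4 (λ a b c d → (a :+ b) :+ (c :+ d) := (a :+ c) :+ (b :+ d)) refl
                 (f zero) (g zero) (sumℚ (λ i → f (suc i))) (sumℚ (λ i → g (suc i))))

  sum-*l : ∀ {k} (c : ℚ) (f : Fin k → ℚ) → sumℚ (λ i → c * f i) ≡ c * sumℚ f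
  sum-*l {zero}  c f = sym (ℚP.*-zeroʳ c)
  sum-*l {suc k} c f = trans (cong (λ x → c * f zero + x) (sum-*l c (λ i → f (suc i))))
                             (sym (ℚP.*-distribˡ-+ c (f zero) _))

  sum-*r : ∀ {k} (c : ℚ) (f : Fin k → ℚ) → sumℚ (λ i → f i * c) ≡ sumℚ f * c
  sum-*r c f = trans (sum-cong (λ i → ℚP.*-comm (f i) c)) (trans (sum-*l c f) (ℚP.*-comm c _))

  sum-0 : ∀ {k} → sumℚ {k} (λ _ → 0ℚ) ≡ 0ℚ
  sum-0 {zero}  = refl
  sum-0 {suc k} = trans (ℚP.+-identityˡ _) (sum-0 {k})

  sum-neg : ∀ {k} (f : Fin k → ℚ) → sumℚ (λ i → ℚ.- f i) ≡ ℚ.- sumℚ f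
  sum-neg {zero}  f = refl
  sum-neg {suc k} f = trans (cong (λ x → ℚ.- f zero + x) (sum-neg (λ i → f (suc i))))
                            (sym (ℚP.neg-distrib-+ (f zero) _))

  sum-- : ∀ {k} (f g : Fin k → ℚ) → sumℚ (λ i → f i - g i) ≡ sumℚ f - sumℚ g
  sum-- f g = trans (sum-+ f (λ i → ℚ.- g i)) (cong (λ x → sumℚ f + x) (sum-neg g))

  sum-swap : ∀ {k l} (f : Fin k → Fin l → ℚ) →
             sumℚ (λ i → sumℚ (λ j → f i j)) ≡ sumℚ (λ j → sumℚ (λ i → f i j))
  sum-swap {zero}  {l} f = sym (sum-0 {l})
  sum-swap {suc k} {l} f =
    trans (cong (λ x → sumℚ (λ j → f zero j) + x) (sum-swap (λ i → f (suc i))))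
          (sym (sum-+ (λ j → f zero j) (λ j → sumℚ (λ i → f (suc i) j))))

  sum-const : ∀ {k} (c : ℚ) → sumℚ {k} (λ _ → c) ≡ ℕ→ℚ k * c
  sum-const {zero}  c = sym (ℚP.*-zeroˡ c)
  sum-const {suc k} c = trans (cong (λ x → c + x) (sum-const {k} c))
    (trans (solve 2 (λ c K → c :+ K :* c := (con 1ℚ :+ K) :* c) refl c (ℕ→ℚ k))
           (cong (_* c) (sym (ι-+ (+ 1) (+ k)))))

  ι-sum : ∀ {k} (f : Fin k → ℤ) → ι (sumℤ f) ≡ sumℚ (λ i → ι (f i))
  ι-sum {zero}  f = refl
  ι-sum {suc k} f = trans (ι-+ (f zero) _) (cong (λ x → ι (f zero) + x) (ι-sum (λ i → f (suc i))))

  sum-mono : ∀ {k} {f g : Fin k → ℚ} → (∀ i → f i ≤ g i) → sumℚ f ≤ sumℚ g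
  sum-mono {zero}  h = ℚP.≤-refl
  sum-mono {suc k} h = ℚP.+-mono-≤ (h zero) (sum-mono (λ i → h (suc i)))

  sum-abs : ∀ {k} (f : Fin k → ℚ) → ∣ sumℚ f ∣ ≤ sumℚ (λ i → ∣ f i ∣)
  sum-abs {zero}  f = ℚP.≤-refl
  sum-abs {suc k} f = ℚP.≤-trans (ℚP.∣p+q∣≤∣p∣+∣q∣ (f zero) _)
                                 (ℚP.+-monoʳ-≤ ∣ f zero ∣ (sum-abs (λ i → f (suc i))))

  sum-nonneg : ∀ {k} {f : Fin k → ℚ} → (∀ i → 0ℚ ≤ f i) → 0ℚ ≤ sumℚ f
  sum-nonneg {k} h = ℚP.≤-trans (ℚP.≤-reflexive (sym (sum-0 {k}))) (sum-mono h)

  sum-≥-term : ∀ {k} {f : Fin k → ℚ} → (∀ i → 0ℚ ≤ f i) → ∀ i → f i ≤ sumℚ f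
  sum-≥-term {suc k} {f} h zero = ℚP.≤-trans (ℚP.≤-reflexive (sym (ℚP.+-identityʳ (f zero))))
                                             (ℚP.+-monoʳ-≤ (f zero) (sum-nonneg (λ i → h (suc i))))
  sum-≥-term {suc k} {f} h (suc i) =
    ℚP.≤-trans (sum-≥-term (λ j → h (suc j)) i)
               (ℚP.≤-trans (ℚP.≤-reflexive (sym (ℚP.+-identityˡ _))) (ℚP.+-monoˡ-≤ _ (h zero)))

  sum-bound : ∀ {k} {f : Fin k → ℚ} (c : ℚ) → (∀ i → f i ≤ c) → sumℚ f ≤ ℕ→ℚ k * c
  sum-bound {k} c h = ℚP.≤-trans (sum-mono h) (ℚP.≤-reflexive (sum-const {k} c))

  δ : ∀ {k} → Fin k → Fin k → ℚ
  δ i j with i Fin.≟ j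
  ... | yes _ = 1ℚ
  ... | no _  = 0ℚ

  δ-refl : ∀ {k} (i : Fin k) → δ i i ≡ 1ℚ
  δ-refl i with i Fin.≟ i
  ... | yes _ = refl
  ... | no ne = ⊥-elim (ne refl)

  δ-ne : ∀ {k} {i j : Fin k} → ¬ i ≡ j → δ i j ≡ 0ℚ
  δ-ne {i = i} {j} ne with i Fin.≟ j
  ... | yes e = ⊥-elim (ne e)
  ... | no _  = refl

  δ-sym : ∀ {k} (i j : Fin k) → δ i j ≡ δ j i
  δ-sym i j with i Fin.≟ j | j Fin.≟ i
  ... | yes _ | yes _  = refl
  ... | no _  | no _   = refl
  ... | yes e | no ne  = ⊥-elim (ne (sym e))
  ... | no ne | yes e  = ⊥-elim (ne (sym e))

  δ-suc : ∀ {k} (i j : Fin k) → δ (suc i) (suc j) ≡ δ i j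
  δ-suc i j with suc i Fin.≟ suc j | i Fin.≟ j
  ... | yes _ | yes _  = refl
  ... | no _  | no _   = refl
  ... | yes e | no ne  = ⊥-elim (ne (FinP.suc-injective e))
  ... | no ne | yes e  = ⊥-elim (ne (cong suc e))

  δ-01 : ∀ {k} (i j : Fin k) → δ i j ≡ 0ℚ ⊎ δ i j ≡ 1ℚ
  δ-01 i j with i Fin.≟ j
  ... | yes _ = inj₂ refl
  ... | no _  = inj₁ refl

  sum-δ : ∀ {k} (i : Fin k) (f : Fin k → ℚ) → sumℚ (λ j → δ i j * f j) ≡ f i
  sum-δ {suc k} zero f =
    trans (cong₂ _+_ (cong (_* f zero) (δ-refl {suc k} zero))
                     (trans (sum-cong (λ j → cong (_* f (suc j)) (δ-ne {i = zero} {suc j} (λ ()))))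
                            (trans (sum-cong (λ j → ℚP.*-zeroˡ (f (suc j)))) (sum-0 {k}))))
          (trans (ℚP.+-identityʳ _) (ℚP.*-identityˡ _))
  sum-δ {suc k} (suc i) f =
    trans (cong₂ _+_ (trans (cong (_* f zero) (δ-ne {i = suc i} {zero} (λ ()))) (ℚP.*-zeroˡ (f zero)))
                     (trans (sum-cong (λ j → cong (_* f (suc j)) (δ-suc i j))) (sum-δ i (λ j → f (suc j)))))
          (ℚP.+-identityˡ _)

  sum-δʳ : ∀ {k} (i : Fin k) (f : Fin k → ℚ) → sumℚ (λ j → f j * δ j i) ≡ f i
  sum-δʳ i f = trans (sum-cong (λ j → trans (ℚP.*-comm (f j) (δ j i)) (cong (_* f j) (δ-sym j i))))
                     (sum-δ i f)

  sum-δᵗ : ∀ {k} (c : Fin k → ℚ) (j : Fin k) → sumℚ (λ i → c i * δ j i) ≡ c j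
  sum-δᵗ c j = trans (sum-cong (λ i → ℚP.*-comm (c i) (δ j i))) (sum-δ j c)

open FiniteSums

module OrderedField where
  open ℚSolver.+-*-Solver

  0≤1 : 0ℚ ≤ 1ℚ
  0≤1 = ℚP.≤ᵇ⇒≤ tt

  two≥0 : 0ℚ ≤ two
  two≥0 = ℚP.≤ᵇ⇒≤ tt

  mulL : ∀ {c a b} → 0ℚ ≤ c → a ≤ b → c * a ≤ c * b
  mulL {c} h ab = ℚP.*-monoˡ-≤-nonNeg c {{ℚ.nonNegative h}} ab

  mulR : ∀ {c a b} → 0ℚ ≤ c → a ≤ b → a * c ≤ b * c
  mulR {c} h ab = ℚP.*-monoʳ-≤-nonNeg c {{ℚ.nonNegative h}} ab

  mul≥0 : ∀ {a b} → 0ℚ ≤ a → 0ℚ ≤ b → 0ℚ ≤ a * b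
  mul≥0 {a} {b} ha hb = ℚP.≤-trans (ℚP.≤-reflexive (sym (ℚP.*-zeroˡ b))) (mulR hb ha)

  mul-mono : ∀ {a b c d} → 0ℚ ≤ a → 0ℚ ≤ c → a ≤ b → c ≤ d → a * c ≤ b * d
  mul-mono ha hc ab cd = ℚP.≤-trans (mulL ha cd) (mulR (ℚP.≤-trans hc cd) ab)

  le-mul1 : ∀ {c x} → 1ℚ ≤ c → 0ℚ ≤ x → x ≤ c * x
  le-mul1 {c} {x} hc hx = ℚP.≤-trans (ℚP.≤-reflexive (sym (ℚP.*-identityˡ x))) (mulR hx hc)

  +-cancelʳ-≤ : ∀ {a b c} → a + b ≤ c + b → a ≤ c
  +-cancelʳ-≤ {a} {b} {c} h =
    ℚP.≤-trans (ℚP.≤-reflexive (shift a))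
      (ℚP.≤-trans (ℚP.+-monoˡ-≤ (ℚ.- b) h) (ℚP.≤-reflexive (sym (shift c))))
    where
    shift : ∀ x → x ≡ x + b + ℚ.- b
    shift x = solve 2 (λ x b → x := x :+ b :+ (:- b)) refl x b

  abs-mul-le : ∀ {a x b y} → ∣ a ∣ ≤ b → ∣ x ∣ ≤ y → ∣ a * x ∣ ≤ b * y
  abs-mul-le {a} {x} h1 h2 = ℚP.≤-trans (ℚP.≤-reflexive (ℚP.∣p*q∣≡∣p∣*∣q∣ a x))
                                        (mul-mono (ℚP.0≤∣p∣ a) (ℚP.0≤∣p∣ x) h1 h2)

  sq-abs : ∀ x → ∣ x ∣ * ∣ x ∣ ≡ x * x
  sq-abs x with ℚP.∣p∣≡p∨∣p∣≡-p x
  ... | inj₁ e = cong₂ _*_ e e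
  ... | inj₂ e = trans (cong₂ _*_ e e) (solve 1 (λ x → (:- x) :* (:- x) := x :* x) refl x)

  sq≥0 : ∀ x → 0ℚ ≤ x * x
  sq≥0 x = ℚP.≤-trans (mul≥0 (ℚP.0≤∣p∣ x) (ℚP.0≤∣p∣ x)) (ℚP.≤-reflexive (sq-abs x))

  nonZero : ∀ {x} → 0ℚ < x → ℚ.NonZero x
  nonZero h = ℚ.>-nonZero h

  cancel0 : ∀ {x y} → 0ℚ < x → x * y ≡ 0ℚ → y ≡ 0ℚ
  cancel0 {x} {y} h e = begin
      y                                    ≡⟨ sym (ℚP.*-identityˡ y) ⟩
      1ℚ * y                               ≡⟨ cong (_* y) (sym (ℚP.*-inverseˡ x {{nonZero h}})) ⟩
      (1/ x) {{nonZero h}} * x * y         ≡⟨ ℚP.*-assoc ((1/ x) {{nonZero h}}) x y ⟩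
      (1/ x) {{nonZero h}} * (x * y)       ≡⟨ cong ((1/ x) {{nonZero h}} *_) e ⟩
      (1/ x) {{nonZero h}} * 0ℚ            ≡⟨ ℚP.*-zeroʳ ((1/ x) {{nonZero h}}) ⟩
      0ℚ                                   ∎
    where open ≡-Reasoning

  cancelL : ∀ {x a b} → 0ℚ < x → x * a ≡ x * b → a ≡ b
  cancelL {x} {a} {b} h e = begin
      a              ≡⟨ solve 2 (λ a b → a := (a :- b) :+ b) refl a b ⟩
      (a - b) + b    ≡⟨ cong (_+ b) (cancel0 h x[a-b]≡0) ⟩
      0ℚ + b         ≡⟨ ℚP.+-identityˡ b ⟩
      b              ∎
    where
    open ≡-Reasoning
    x[a-b]≡0 : x * (a - b) ≡ 0ℚ
    x[a-b]≡0 = trans (solve 3 (λ x a b → x :* (a :- b) := x :* a :- x :* b) refl x a b)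
                     (trans (cong (_- x * b) e) (ℚP.+-inverseʳ (x * b)))

  pow-pos : ∀ {x} → 0ℚ < x → ∀ e → 0ℚ < powℚ x e
  pow-pos h zero = ℚP.positive⁻¹ 1ℚ
  pow-pos {x} h (suc e) = ℚP.≤-<-trans (ℚP.≤-reflexive (sym (ℚP.*-zeroˡ (powℚ x e))))
    (ℚP.*-monoˡ-<-pos (powℚ x e) {{ℚ.positive (pow-pos h e)}} h)

  pow-nonneg : ∀ {x} → 0ℚ ≤ x → ∀ e → 0ℚ ≤ powℚ x e
  pow-nonneg h zero    = 0≤1
  pow-nonneg h (suc e) = mul≥0 h (pow-nonneg h e)

  pow≥1 : ∀ {x} → 1ℚ ≤ x → ∀ e → 1ℚ ≤ powℚ x e
  pow≥1 h zero    = ℚP.≤-refl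
  pow≥1 h (suc e) = ℚP.≤-trans (ℚP.≤ᵇ⇒≤ {1ℚ} {1ℚ * 1ℚ} tt) (mul-mono 0≤1 0≤1 h (pow≥1 h e))

  pow-mono : ∀ {x y} → 0ℚ ≤ x → x ≤ y → ∀ e → powℚ x e ≤ powℚ y e
  pow-mono h xy zero    = ℚP.≤-refl
  pow-mono h xy (suc e) = mul-mono h (pow-nonneg h e) xy (pow-mono h xy e)

  pow-* : ∀ x y e → powℚ (x * y) e ≡ powℚ x e * powℚ y e
  pow-* x y zero    = refl
  pow-* x y (suc e) = trans (cong (x * y *_) (pow-* x y e))
    (solve 4 (λ x y a b → x :* y :* (a :* b) := x :* a :* (y :* b)) refl x y (powℚ x e) (powℚ y e))

  pow-+ : ∀ x a b → powℚ x (a ℕ.+ b) ≡ powℚ x a * powℚ x b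
  pow-+ x zero    b = sym (ℚP.*-identityˡ _)
  pow-+ x (suc a) b = trans (cong (x *_) (pow-+ x a b)) (sym (ℚP.*-assoc x _ _))

open OrderedField

module InnerProduct where
  open ℚSolver.+-*-Solver

  dot-sym : ∀ {m} (u w : Vecℚ m) → dot u w ≡ dot w u
  dot-sym u w = sum-cong (λ c → ℚP.*-comm (u c) (w c))

  dot-sub : ∀ {m} (u w z : Vecℚ m) → dot u (λ a → w a - z a) ≡ dot u w - dot u z
  dot-sub {m} u w z =
    trans (sum-cong {m} (λ a → solve 3 (λ u w z → u :* (w :- z) := u :* w :- u :* z) refl (u a) (w a) (z a)))
          (sum-- {m} (λ a → u a * w a) (λ a → u a * z a))

  dot-lin : ∀ {m} (u w z : Vecℚ m) (t : ℚ) → dot u (λ a → w a - t * z a) ≡ dot u w - t * dot u z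
  dot-lin {m} u w z t =
    trans (sum-cong {m} (λ a → solve 4 (λ u w t z → u :* (w :- t :* z) := u :* w :- t :* (u :* z))
                                       refl (u a) (w a) t (z a)))
    (trans (sum-- {m} (λ a → u a * w a) (λ a → t * (u a * z a)))
           (cong (dot u w -_) (sum-*l {m} t (λ a → u a * z a))))

  dot-lincomb : ∀ {m l} (u : Vecℚ m) (c : Fin l → ℚ) (ys : Fin l → Vecℚ m) →
                dot u (lincomb c ys) ≡ sumℚ (λ i → c i * dot u (ys i))
  dot-lincomb {m} {l} u c ys = begin
      sumℚ (λ a → u a * sumℚ (λ i → c i * ys i a))
    ≡⟨ sum-cong {m} (λ a → sym (sum-*l {l} (u a) (λ i → c i * ys i a))) ⟩
      sumℚ (λ a → sumℚ (λ i → u a * (c i * ys i a)))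
    ≡⟨ sum-swap {m} {l} (λ a i → u a * (c i * ys i a)) ⟩
      sumℚ (λ i → sumℚ (λ a → u a * (c i * ys i a)))
    ≡⟨ sum-cong {l} (λ i → trans (sum-cong {m} (λ a → solve 3 (λ u c y → u :* (c :* y) := c :* (u :* y))
                                                               refl (u a) (c i) (ys i a)))
                                 (sum-*l {m} (c i) (λ a → u a * ys i a))) ⟩
      sumℚ (λ i → c i * dot u (ys i)) ∎
    where open ≡-Reasoning

  dot-expand : ∀ {m} (c : ℚ) (x y z t : Vecℚ m) →
    dot (λ a → c * x a + y a) (λ a → c * z a + t a) ≡ c * c * dot x z + c * (dot x t + dot y z) + dot y t
  dot-expand {m} c x y z t = begin
      sumℚ (λ a → (c * x a + y a) * (c * z a + t a))
    ≡⟨ sum-cong {m} (λ a → solve 5 (λ c x y z t → (c :* x :+ y) :* (c :* z :+ t)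
                                    := c :* c :* (x :* z) :+ c :* (x :* t :+ y :* z) :+ y :* t)
                                   refl c (x a) (y a) (z a) (t a)) ⟩
      sumℚ (λ a → c * c * (x a * z a) + c * (x a * t a + y a * z a) + y a * t a)
    ≡⟨ sum-+ {m} (λ a → c * c * (x a * z a) + c * (x a * t a + y a * z a)) (λ a → y a * t a) ⟩
      sumℚ (λ a → c * c * (x a * z a) + c * (x a * t a + y a * z a)) + dot y t
    ≡⟨ cong (_+ dot y t) (sum-+ {m} (λ a → c * c * (x a * z a)) (λ a → c * (x a * t a + y a * z a))) ⟩
      sumℚ (λ a → c * c * (x a * z a)) + sumℚ (λ a → c * (x a * t a + y a * z a)) + dot y t
    ≡⟨ cong₂ (λ p q → p + q + dot y t) (sum-*l {m} (c * c) (λ a → x a * z a))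
             (trans (sum-*l {m} c (λ a → x a * t a + y a * z a))
                    (cong (c *_) (sum-+ {m} (λ a → x a * t a) (λ a → y a * z a)))) ⟩
      c * c * dot x z + c * (dot x t + dot y z) + dot y t ∎
    where open ≡-Reasoning

  dot-bound : ∀ {m} (u w : Vecℚ m) (B B' : ℚ) → (∀ a → ∣ u a ∣ ≤ B) → (∀ a → ∣ w a ∣ ≤ B') →
              ∣ dot u w ∣ ≤ ℕ→ℚ m * (B * B')
  dot-bound {m} u w B B' hu hw = ℚP.≤-trans (sum-abs {m} (λ a → u a * w a))
                                            (sum-bound {m} (B * B') (λ a → abs-mul-le (hu a) (hw a)))

  ι-normSq : ∀ {m} (u : Fin m → ℤ) → normSqℤ u ℚ./ 1 ≡ dot (toℚ u) (toℚ u)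
  ι-normSq {m} u = trans (ι-sum {m} (λ a → u a ℤ.* u a)) (sum-cong {m} (λ a → ι-* (u a) (u a)))

open InnerProduct

-- Indeed A = A H G = K G + X with X = A R G; bounding X by the total
-- absolute mass T of G gives K T ≤ n²(α + nαρT) ≤ n²α + KT/2, hence
-- K T ≤ 2n²α and K |X| ≤ nαρ K T.
module InversePerturbation {n : ℕ} (G H A M R : Fin n → Fin n → ℚ) (K α ρ : ℚ)
    (HG≡I : ∀ m i → sumℚ {n} (λ j → H m j * G j i) ≡ δ m i)
    (AM≡I : ∀ i j → sumℚ {n} (λ l → A i l * M l j) ≡ δ i j)
    (H≡KM+R : ∀ m j → H m j ≡ K * M m j + R m j)
    (A-bound : ∀ i j → ∣ A i j ∣ ≤ α)
    (R-bound : ∀ i j → ∣ R i j ∣ ≤ ρ)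
    (ρ≥0 : 0ℚ ≤ ρ) (K≥0 : 0ℚ ≤ K) (α≥0 : 0ℚ ≤ α)
    (K-large : ℕ→ℚ 2 * (ℕ→ℚ n * ℕ→ℚ n * ℕ→ℚ n) * α * ρ ≤ K) where
  open ℚSolver.+-*-Solver

  N : ℚ
  N = ℕ→ℚ n

  X : Fin n → Fin n → ℚ
  X i l = sumℚ {n} (λ m → A i m * sumℚ {n} (λ j → R m j * G j l))

  A≡KG+X : ∀ i l → A i l ≡ K * G i l + X i l
  A≡KG+X i l = begin
      A i l
    ≡⟨ sym (sum-δʳ l (A i)) ⟩
      sumℚ {n} (λ m → A i m * δ m l)
    ≡⟨ sum-cong {n} (λ m → cong (A i m *_) (sym (HG≡I m l))) ⟩
      sumℚ {n} (λ m → A i m * sumℚ {n} (λ j → H m j * G j l))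
    ≡⟨ sum-cong {n} (λ m → cong (A i m *_) (split m)) ⟩
      sumℚ {n} (λ m → A i m * (sumℚ {n} (λ j → K * M m j * G j l) + sumℚ {n} (λ j → R m j * G j l)))
    ≡⟨ trans (sum-cong {n} (λ m → ℚP.*-distribˡ-+ (A i m) _ _)) (sum-+ {n} _ _) ⟩
      sumℚ {n} (λ m → A i m * sumℚ {n} (λ j → K * M m j * G j l)) + X i l
    ≡⟨ cong (_+ X i l) main ⟩
      K * G i l + X i l ∎
    where
    open ≡-Reasoning
    split : ∀ m → sumℚ {n} (λ j → H m j * G j l)
                  ≡ sumℚ {n} (λ j → K * M m j * G j l) + sumℚ {n} (λ j → R m j * G j l)
    split m = trans (sum-cong {n} (λ j → trans (cong (_* G j l) (H≡KM+R m j))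
                                               (ℚP.*-distribʳ-+ (G j l) (K * M m j) (R m j))))
                    (sum-+ {n} _ _)
    main : sumℚ {n} (λ m → A i m * sumℚ {n} (λ j → K * M m j * G j l)) ≡ K * G i l
    main = begin
        sumℚ {n} (λ m → A i m * sumℚ {n} (λ j → K * M m j * G j l))
      ≡⟨ sum-cong {n} (λ m → sym (sum-*l {n} (A i m) _)) ⟩
        sumℚ {n} (λ m → sumℚ {n} (λ j → A i m * (K * M m j * G j l)))
      ≡⟨ sum-swap {n} {n} _ ⟩
        sumℚ {n} (λ j → sumℚ {n} (λ m → A i m * (K * M m j * G j l)))
      ≡⟨ sum-cong {n} (λ j → trans (sum-cong {n} (λ m → regroup (A i m) (M m j) (G j l)))
                                   (sum-*r {n} (K * G j l) _)) ⟩
        sumℚ {n} (λ j → sumℚ {n} (λ m → A i m * M m j) * (K * G j l))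
      ≡⟨ sum-cong {n} (λ j → cong (_* (K * G j l)) (AM≡I i j)) ⟩
        sumℚ {n} (λ j → δ i j * (K * G j l))
      ≡⟨ sum-δ i (λ j → K * G j l) ⟩
        K * G i l ∎
      where
      regroup : ∀ a mm g → a * (K * mm * g) ≡ a * mm * (K * g)
      regroup a mm g = solve 4 (λ a k mm g → a :* (k :* mm :* g) := (a :* mm) :* (k :* g)) refl a K mm g

  T : ℚ
  T = sumℚ {n} (λ j → sumℚ {n} (λ l → ∣ G j l ∣))

  T≥0 : 0ℚ ≤ T
  T≥0 = sum-nonneg {n} (λ j → sum-nonneg {n} (λ l → ℚP.0≤∣p∣ (G j l)))

  column≤T : ∀ l → sumℚ {n} (λ j → ∣ G j l ∣) ≤ T
  column≤T l = sum-mono {n} (λ j → sum-≥-term {n} (λ l' → ℚP.0≤∣p∣ (G j l')) l)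

  X-bound : ∀ i l → ∣ X i l ∣ ≤ N * α * ρ * T
  X-bound i l = begin
      ∣ X i l ∣
    ≤⟨ sum-abs {n} _ ⟩
      sumℚ {n} (λ m → ∣ A i m * sumℚ {n} (λ j → R m j * G j l) ∣)
    ≤⟨ sum-mono {n} (λ m → abs-mul-le (A-bound i m) inner) ⟩
      sumℚ {n} (λ m → α * (ρ * T))
    ≡⟨ sum-const {n} (α * (ρ * T)) ⟩
      N * (α * (ρ * T))
    ≡⟨ solve 4 (λ N a r t → N :* (a :* (r :* t)) := N :* a :* r :* t) refl N α ρ T ⟩
      N * α * ρ * T ∎
    where
    open ℚP.≤-Reasoning
    inner : ∀ {m} → ∣ sumℚ {n} (λ j → R m j * G j l) ∣ ≤ ρ * T
    inner {m} = begin
        ∣ sumℚ {n} (λ j → R m j * G j l) ∣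
      ≤⟨ sum-abs {n} _ ⟩
        sumℚ {n} (λ j → ∣ R m j * G j l ∣)
      ≤⟨ sum-mono {n} (λ j → abs-mul-le (R-bound m j) (ℚP.≤-refl {∣ G j l ∣})) ⟩
        sumℚ {n} (λ j → ρ * ∣ G j l ∣)
      ≡⟨ sum-*l {n} ρ _ ⟩
        ρ * sumℚ {n} (λ j → ∣ G j l ∣)
      ≤⟨ mulL ρ≥0 (column≤T l) ⟩
        ρ * T ∎

  KG-bound : ∀ i l → K * ∣ G i l ∣ ≤ α + N * α * ρ * T
  KG-bound i l = begin
      K * ∣ G i l ∣
    ≡⟨ cong (_* ∣ G i l ∣) (sym (ℚP.0≤p⇒∣p∣≡p K≥0)) ⟩
      ∣ K ∣ * ∣ G i l ∣
    ≡⟨ sym (ℚP.∣p*q∣≡∣p∣*∣q∣ K (G i l)) ⟩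
      ∣ K * G i l ∣
    ≡⟨ cong ∣_∣ (solve 2 (λ kg x → kg := (kg :+ x) :- x) refl (K * G i l) (X i l)) ⟩
      ∣ (K * G i l + X i l) - X i l ∣
    ≡⟨ cong (λ z → ∣ z - X i l ∣) (sym (A≡KG+X i l)) ⟩
      ∣ A i l - X i l ∣
    ≤⟨ ℚP.∣p-q∣≤∣p∣+∣q∣ (A i l) (X i l) ⟩
      ∣ A i l ∣ + ∣ X i l ∣
    ≤⟨ ℚP.+-mono-≤ (A-bound i l) (X-bound i l) ⟩
      α + N * α * ρ * T ∎
    where open ℚP.≤-Reasoning

  KT-bound : K * T ≤ ℕ→ℚ 2 * (N * N * α)
  KT-bound = +-cancelʳ-≤ twice
    where
    open ℚP.≤-Reasoning
    c : ℚ
    c = α + N * α * ρ * T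
    summed : K * T ≤ N * (N * c)
    summed = begin
        K * T
      ≡⟨ sym (sum-*l {n} K _) ⟩
        sumℚ {n} (λ j → K * sumℚ {n} (λ l → ∣ G j l ∣))
      ≡⟨ sum-cong {n} (λ j → sym (sum-*l {n} K _)) ⟩
        sumℚ {n} (λ j → sumℚ {n} (λ l → K * ∣ G j l ∣))
      ≤⟨ sum-mono {n} (λ j → sum-mono {n} (λ l → KG-bound j l)) ⟩
        sumℚ {n} (λ j → sumℚ {n} (λ l → c))
      ≡⟨ trans (sum-cong {n} (λ j → sum-const {n} c)) (sum-const {n} _) ⟩
        N * (N * c) ∎
    twice : K * T + K * T ≤ ℕ→ℚ 2 * (N * N * α) + K * T
    twice = begin
        K * T + K * T
      ≤⟨ ℚP.+-mono-≤ summed summed ⟩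
        N * (N * c) + N * (N * c)
      ≡⟨ solve 4 (λ N a r t → N :* (N :* (a :+ N :* a :* r :* t)) :+ N :* (N :* (a :+ N :* a :* r :* t))
                      := con (ℕ→ℚ 2) :* (N :* N :* a) :+ con (ℕ→ℚ 2) :* (N :* N :* N) :* a :* r :* t)
               refl N α ρ T ⟩
        ℕ→ℚ 2 * (N * N * α) + ℕ→ℚ 2 * (N * N * N) * α * ρ * T
      ≤⟨ ℚP.+-monoʳ-≤ (ℕ→ℚ 2 * (N * N * α)) (mulR T≥0 K-large) ⟩
        ℕ→ℚ 2 * (N * N * α) + K * T ∎

  inverse-perturbation : ∀ i l → K * ∣ A i l - K * G i l ∣ ≤ ℕ→ℚ 2 * (N * N * N) * α * α * ρ
  inverse-perturbation i l = begin
      K * ∣ A i l - K * G i l ∣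
    ≡⟨ cong (λ z → K * ∣ z ∣) A-KG≡X ⟩
      K * ∣ X i l ∣
    ≤⟨ mulL K≥0 (X-bound i l) ⟩
      K * (N * α * ρ * T)
    ≡⟨ solve 5 (λ k N a r t → k :* (N :* a :* r :* t) := N :* a :* r :* (k :* t)) refl K N α ρ T ⟩
      N * α * ρ * (K * T)
    ≤⟨ mulL (mul≥0 (mul≥0 (ℕ→ℚ≥0 n) α≥0) ρ≥0) KT-bound ⟩
      N * α * ρ * (ℕ→ℚ 2 * (N * N * α))
    ≡⟨ solve 3 (λ N a r → N :* a :* r :* (con (ℕ→ℚ 2) :* (N :* N :* a))
                          := con (ℕ→ℚ 2) :* (N :* N :* N) :* a :* a :* r) refl N α ρ ⟩
      ℕ→ℚ 2 * (N * N * N) * α * α * ρ ∎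
    where
    open ℚP.≤-Reasoning
    A-KG≡X : A i l - K * G i l ≡ X i l
    A-KG≡X = trans (cong (_- K * G i l) (A≡KG+X i l))
                   (solve 2 (λ kg x → kg :+ x :- kg := x) refl (K * G i l) (X i l))

open InversePerturbation using (inverse-perturbation)

-- The lattice D_n^* (n = r + 1) has the basis
--   a_0 = (½, …, ½),  a_(d+1) = (0, …, 0, 1, …, 1)  (ones in positions > d),
-- and b_0 = 2 e_0, b_(d+1) = e_(d+1) - e_d is the dual basis (a_i · b_j = δ_ij),
-- a basis of D_n.  Hence every y ∈ ℚ^n equals Σ_l (y · b_l) a_l, and the Gram
-- matrices of (a_i) and (b_j) are mutually inverse.
module DnDualBasis where
  open ℚSolver.+-*-Solver

  ind< : ℕ → ℕ → ℚ
  ind< m       zero    = 0ℚ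
  ind< zero    (suc k) = 1ℚ
  ind< (suc m) (suc k) = ind< m k

  ind≡ : ℕ → ℕ → ℚ
  ind≡ zero    zero    = 1ℚ
  ind≡ zero    (suc k) = 0ℚ
  ind≡ (suc m) zero    = 0ℚ
  ind≡ (suc m) (suc k) = ind≡ m k

  ind<-step : ∀ m k → ind< m (suc k) - ind< m k ≡ ind≡ m k
  ind<-step zero    zero    = refl
  ind<-step zero    (suc k) = refl
  ind<-step (suc m) zero    = refl
  ind<-step (suc m) (suc k) = ind<-step m k

  ind≡-sym : ∀ m j → ind≡ m j ≡ ind≡ j m
  ind≡-sym zero    zero    = refl
  ind≡-sym zero    (suc j) = refl
  ind≡-sym (suc m) zero    = refl
  ind≡-sym (suc m) (suc j) = ind≡-sym m j

  ind<-int : ∀ m k → IsInt (ind< m k)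
  ind<-int m       zero    = + 0 , refl
  ind<-int zero    (suc k) = + 1 , refl
  ind<-int (suc m) (suc k) = ind<-int m k

  ind<-01 : ∀ m k → ind< m k ≡ 0ℚ ⊎ ind< m k ≡ 1ℚ
  ind<-01 m       zero    = inj₁ refl
  ind<-01 zero    (suc k) = inj₂ refl
  ind<-01 (suc m) (suc k) = ind<-01 m k

  δ≡ind≡ : ∀ {k} (i j : Fin k) → δ i j ≡ ind≡ (toℕ i) (toℕ j)
  δ≡ind≡ {suc k} zero zero = δ-refl {suc k} zero
  δ≡ind≡ zero    (suc j)   = δ-ne {i = zero} {j = suc j} (λ ())
  δ≡ind≡ (suc i) zero      = δ-ne {i = suc i} {j = zero} (λ ())
  δ≡ind≡ (suc i) (suc j)   = trans (δ-suc i j) (δ≡ind≡ i j)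

  dualBasis : ∀ {r} → Fin (suc r) → Vecℚ (suc r)
  dualBasis zero    c = ½
  dualBasis (suc d) c = ind< (toℕ d) (toℕ c)

  dnBasis : ∀ {r} → Fin (suc r) → Vecℚ (suc r)
  dnBasis zero    c = two * δ zero c
  dnBasis (suc d) c = δ (suc d) c - δ (inject₁ d) c

  dot-b₀ : ∀ {r} (u : Vecℚ (suc r)) → dot u (dnBasis zero) ≡ two * u zero
  dot-b₀ {r} u =
    trans (sum-cong (λ c → solve 3 (λ x t d → x :* (t :* d) := t :* (d :* x)) refl (u c) two (δ zero c)))
          (trans (sum-*l {suc r} two (λ c → δ zero c * u c)) (cong (two *_) (sum-δ zero u)))

  dot-bₛ : ∀ {r} (u : Vecℚ (suc r)) (d : Fin r) → dot u (dnBasis (suc d)) ≡ u (suc d) - u (inject₁ d)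
  dot-bₛ {r} u d =
    trans (sum-cong (λ c → solve 3 (λ x a b → x :* (a :- b) := a :* x :- b :* x) refl
                                   (u c) (δ (suc d) c) (δ (inject₁ d) c)))
    (trans (sum-- {suc r} (λ c → δ (suc d) c * u c) (λ c → δ (inject₁ d) c * u c))
           (cong₂ _-_ (sum-δ (suc d) u) (sum-δ (inject₁ d) u)))

  biorthogonal : ∀ {r} (i j : Fin (suc r)) → dot (dualBasis i) (dnBasis j) ≡ δ i j
  biorthogonal {r} zero zero =
    trans (dot-b₀ {r} (dualBasis zero))
          (trans (solve 0 (con two :* con ½ := con 1ℚ) refl) (sym (δ-refl {suc r} zero)))
  biorthogonal (suc d) zero =
    trans (dot-b₀ (dualBasis (suc d))) (trans (ℚP.*-zeroʳ two) (sym (δ-ne {i = suc d} {j = zero} (λ ()))))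
  biorthogonal zero (suc d') =
    trans (dot-bₛ (dualBasis zero) d') (trans (ℚP.+-inverseʳ ½) (sym (δ-ne {i = zero} {j = suc d'} (λ ()))))
  biorthogonal (suc d) (suc d') =
    trans (dot-bₛ (dualBasis (suc d)) d')
    (trans (cong (λ x → ind< (toℕ d) (suc (toℕ d')) - ind< (toℕ d) x) (FinP.toℕ-inject₁ d'))
    (trans (ind<-step (toℕ d) (toℕ d')) (sym (trans (δ-suc d d') (δ≡ind≡ d d')))))

  telescoping : ∀ {r} (y : Vecℚ (suc r)) (c : Fin (suc r)) →
    sumℚ (λ d → ind< (toℕ d) (toℕ c) * (y (suc d) - y (inject₁ d))) ≡ y c - y zero
  telescoping {zero} y zero = sym (ℚP.+-inverseʳ (y zero))
  telescoping {suc r} y zero =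
    trans (trans (sum-cong (λ d → ℚP.*-zeroˡ (y (suc d) - y (inject₁ d)))) (sum-0 {suc r}))
          (sym (ℚP.+-inverseʳ (y zero)))
  telescoping {suc r} y (suc c) =
    trans (cong (λ x → 1ℚ * (y (suc zero) - y zero) + x) (telescoping {r} (λ i → y (suc i)) c))
          (solve 3 (λ a b c → con 1ℚ :* (a :- b) :+ (c :- a) := c :- b) refl (y (suc zero)) (y zero) (y (suc c)))

  expansion : ∀ {r} (y : Vecℚ (suc r)) (c : Fin (suc r)) →
              sumℚ (λ l → dot y (dnBasis l) * dualBasis l c) ≡ y c
  expansion {r} y c = begin
      dot y (dnBasis zero) * ½ + sumℚ (λ d → dot y (dnBasis (suc d)) * ind< (toℕ d) (toℕ c))
    ≡⟨ cong₂ _+_ (cong (_* ½) (dot-b₀ y))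
                 (sum-cong (λ d → trans (cong (_* ind< (toℕ d) (toℕ c)) (dot-bₛ y d))
                                        (ℚP.*-comm (y (suc d) - y (inject₁ d)) (ind< (toℕ d) (toℕ c))))) ⟩
      two * y zero * ½ + sumℚ (λ d → ind< (toℕ d) (toℕ c) * (y (suc d) - y (inject₁ d)))
    ≡⟨ cong (λ t → two * y zero * ½ + t) (telescoping y c) ⟩
      two * y zero * ½ + (y c - y zero)
    ≡⟨ solve 2 (λ a b → con two :* a :* con ½ :+ (b :- a) := b) refl (y zero) (y c) ⟩
      y c ∎
    where open ≡-Reasoning

  dualBasis∈Dn* : ∀ {r} (i : Fin (suc r)) → DnDual (suc r) (dualBasis i)
  dualBasis∈Dn* zero    = inj₂ (λ c → + 0 , ℚP.+-inverseʳ ½)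
  dualBasis∈Dn* (suc d) = inj₁ (λ c → ind<-int (toℕ d) (toℕ c))

  -- Pairing a vanishing combination with b_i isolates its i-th coefficient.
  dualBasis-independent : ∀ {r} (cf : Fin (suc r) → ℚ) →
    (∀ j → lincomb cf dualBasis j ≡ 0ℚ) → ∀ i → cf i ≡ 0ℚ
  dualBasis-independent {r} cf h i = begin
      cf i
    ≡⟨ sym (sum-δʳ i cf) ⟩
      sumℚ (λ l → cf l * δ l i)
    ≡⟨ sum-cong (λ l → cong (cf l *_) (sym (biorthogonal l i))) ⟩
      sumℚ (λ l → cf l * sumℚ (λ c → dualBasis l c * dnBasis i c))
    ≡⟨ sum-cong {suc r} (λ l → trans (sym (sum-*l {suc r} (cf l) (λ c → dualBasis l c * dnBasis i c)))
                          (sum-cong {suc r} (λ c → sym (ℚP.*-assoc (cf l) (dualBasis l c) (dnBasis i c))))) ⟩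
      sumℚ (λ l → sumℚ (λ c → cf l * dualBasis l c * dnBasis i c))
    ≡⟨ sum-swap {suc r} {suc r} (λ l c → cf l * dualBasis l c * dnBasis i c) ⟩
      sumℚ (λ c → sumℚ (λ l → cf l * dualBasis l c * dnBasis i c))
    ≡⟨ sum-cong {suc r} (λ c → trans (sum-*r {suc r} (dnBasis i c) (λ l → cf l * dualBasis l c))
                                     (trans (cong (_* dnBasis i c) (h c)) (ℚP.*-zeroˡ (dnBasis i c)))) ⟩
      sumℚ {suc r} (λ c → 0ℚ)
    ≡⟨ sum-0 {suc r} ⟩
      0ℚ ∎
    where open ≡-Reasoning

  pairings-integral : ∀ {r} (y : Vecℚ (suc r)) → DnDual (suc r) y →
    ∃ λ (z : Fin (suc r) → ℤ) → ∀ l → dot y (dnBasis l) ≡ ι (z l)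
  pairings-integral y (inj₁ h) =
    (λ { zero → + 2 ℤ.* proj₁ (h zero) ; (suc d) → proj₁ (h (suc d)) ℤ.- proj₁ (h (inject₁ d)) }) ,
    λ { zero → trans (dot-b₀ y) (trans (cong (two *_) (proj₂ (h zero))) (sym (ι-* (+ 2) (proj₁ (h zero)))))
      ; (suc d) → trans (dot-bₛ y d) (trans (cong₂ _-_ (proj₂ (h (suc d))) (proj₂ (h (inject₁ d))))
                                            (sym (ι-- (proj₁ (h (suc d))) (proj₁ (h (inject₁ d)))))) }
  pairings-integral y (inj₂ h) =
    (λ { zero → + 2 ℤ.* proj₁ (h zero) ℤ.+ + 1 ; (suc d) → proj₁ (h (suc d)) ℤ.- proj₁ (h (inject₁ d)) }) ,
    λ { zero → trans (dot-b₀ y) (trans (double (y zero) (proj₁ (h zero)) (proj₂ (h zero)))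
                 (sym (trans (ι-+ (+ 2 ℤ.* proj₁ (h zero)) (+ 1)) (cong (_+ 1ℚ) (ι-* (+ 2) (proj₁ (h zero)))))))
      ; (suc d) → trans (dot-bₛ y d)
                   (trans (difference (y (suc d)) (y (inject₁ d)) (proj₁ (h (suc d))) (proj₁ (h (inject₁ d)))
                                      (proj₂ (h (suc d))) (proj₂ (h (inject₁ d))))
                          (sym (ι-- (proj₁ (h (suc d))) (proj₁ (h (inject₁ d)))))) }
    where
    double : ∀ x z → x - ½ ≡ ι z → two * x ≡ two * ι z + 1ℚ
    double x z e = trans (solve 1 (λ x → con two :* x := con two :* (x :- con ½) :+ con 1ℚ) refl x)
                         (cong (λ t → two * t + 1ℚ) e)
    difference : ∀ x x' z z' → x - ½ ≡ ι z → x' - ½ ≡ ι z' → x - x' ≡ ι z - ι z'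
    difference x x' z z' e e' = trans (solve 2 (λ x x' → x :- x' := (x :- con ½) :- (x' :- con ½)) refl x x')
                                 (cong₂ _-_ e e')

  dualBasis-spans : ∀ {r} (y : Vecℚ (suc r)) → DnDual (suc r) y →
    ∃ λ (z : Fin (suc r) → ℤ) → ∀ j → y j ≡ lincomb (toℚ z) dualBasis j
  dualBasis-spans y mem with pairings-integral y mem
  ... | z , hz = z , λ j → trans (sym (expansion y j)) (sum-cong (λ l → cong (_* dualBasis l j) (hz l)))

  dualBasis-isBasis : ∀ {r} → IsBasis (DnDual (suc r)) (dualBasis {r})
  dualBasis-isBasis = dualBasis∈Dn* , dualBasis-independent , dualBasis-spans

  gramDual : ∀ {r} → Fin (suc r) → Fin (suc r) → ℚ
  gramDual i j = dot (dualBasis i) (dualBasis j)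

  gram-inverse : ∀ {r} (i j : Fin (suc r)) →
    sumℚ (λ l → gramDual i l * dot (dnBasis l) (dnBasis j)) ≡ δ i j
  gram-inverse {r} i j = begin
      sumℚ (λ l → dot (dualBasis i) (dualBasis l) * dot (dnBasis l) (dnBasis j))
    ≡⟨ sum-cong {suc r} (λ l → trans (cong (dot (dualBasis i) (dualBasis l) *_) (dot-sym (dnBasis l) (dnBasis j)))
                   (trans (sym (sum-*r {suc r} (dot (dnBasis j) (dnBasis l)) (λ c → dualBasis i c * dualBasis l c)))
                          (sum-cong {suc r} (λ c → ℚP.*-comm (dualBasis i c * dualBasis l c) (dot (dnBasis j) (dnBasis l)))))) ⟩
      sumℚ (λ l → sumℚ (λ c → dot (dnBasis j) (dnBasis l) * (dualBasis i c * dualBasis l c)))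
    ≡⟨ sum-swap {suc r} {suc r} (λ l c → dot (dnBasis j) (dnBasis l) * (dualBasis i c * dualBasis l c)) ⟩
      sumℚ (λ c → sumℚ (λ l → dot (dnBasis j) (dnBasis l) * (dualBasis i c * dualBasis l c)))
    ≡⟨ sum-cong (λ c → trans (sum-cong (λ l → solve 3 (λ m a b → m :* (a :* b) := a :* (m :* b)) refl
                                                      (dot (dnBasis j) (dnBasis l)) (dualBasis i c) (dualBasis l c)))
                     (trans (sum-*l {suc r} (dualBasis i c) (λ l → dot (dnBasis j) (dnBasis l) * dualBasis l c))
                            (cong (dualBasis i c *_) (expansion (dnBasis j) c)))) ⟩
      dot (dualBasis i) (dnBasis j)
    ≡⟨ biorthogonal i j ⟩
      δ i j ∎
    where open ≡-Reasoning

open DnDualBasis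

-- For Bézout-coprime P, Q and any k,
-- the chain V_j = P^(r-j) Q^j (0 ≤ j ≤ r) satisfies P V_(j+1) = Q V_j, and
--   v = (2(V_1 + … + V_r) - 2k V_0, V_0, …, V_r) ∈ ℤ^(r+2)
-- is primitive (its entries P^r and Q^r are coprime).  Bézout identities for
-- P^(r-d) and Q^(d+1) give integer solutions X_d of the recurrence
-- P X_d(j+1) - Q X_d(j) = [d = j]; these are the coordinates of the
-- vectors x_(d+1) dual to the f_(d+1) used in ProjectedBasis.
module CoprimeChain where
  open ℤSolver.+-*-Solver

  Coprime : ℤ → ℤ → Set
  Coprime x y = ∃₂ λ α β → α ℤ.* x ℤ.+ β ℤ.* y ≡ + 1

  coprime-sym : ∀ {x y} → Coprime x y → Coprime y x
  coprime-sym {x} {y} (α , β , e) = β , α , trans (ℤP.+-comm (β ℤ.* y) (α ℤ.* x)) e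

  coprime-* : ∀ {x y z} → Coprime x y → Coprime x z → Coprime x (y ℤ.* z)
  coprime-* {x} {y} {z} (a , b , e₁) (c , d , e₂) =
    (a ℤ.* c ℤ.* x ℤ.+ a ℤ.* d ℤ.* z ℤ.+ b ℤ.* c ℤ.* y) , b ℤ.* d ,
    trans (solve 7 (λ a b c d x y z → (a :* c :* x :+ a :* d :* z :+ b :* c :* y) :* x :+ b :* d :* (y :* z)
                      := (a :* x :+ b :* y) :* (c :* x :+ d :* z)) refl a b c d x y z)
          (cong₂ ℤ._*_ e₁ e₂)

  coprime-^ʳ : ∀ {x y} → Coprime x y → ∀ j → Coprime x (y ^ j)
  coprime-^ʳ h zero    = + 0 , + 1 , ℤP.+-identityˡ _
  coprime-^ʳ h (suc j) = coprime-* h (coprime-^ʳ h j)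

  coprime-^ : ∀ {x y} → Coprime x y → ∀ i j → Coprime (x ^ i) (y ^ j)
  coprime-^ h i j = coprime-sym (coprime-^ʳ (coprime-sym (coprime-^ʳ h j)) i)

  -- 2w + 3 and 2w + 1 are coprime: (w+1)(2w+3) - (w+2)(2w+1) = 1.
  coprime-odd-neighbours : ∀ w → Coprime (+ suc (suc (suc (w ℕ.+ w)))) (+ suc (w ℕ.+ w))
  coprime-odd-neighbours w =
    + suc w , ℤ.- (+ suc (suc w)) ,
    solve 1 (λ W → (con (+ 1) :+ W) :* (con (+ 3) :+ W :+ W) :+ (:- (con (+ 2) :+ W)) :* (con (+ 1) :+ W :+ W)
                   := con (+ 1)) refl (+ w)

  gcdVec∣entry : ∀ {m} (u : Fin m → ℤ) a → gcdVec u ∣ᵤ u a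
  gcdVec∣entry {suc m} u zero    = ZG.gcd[i,j]∣i (u zero) (gcdVec (λ i → u (suc i)))
  gcdVec∣entry {suc m} u (suc a) = ℕD.∣-trans (ZG.gcd[i,j]∣j (u zero) (gcdVec (λ i → u (suc i))))
                                              (gcdVec∣entry (λ i → u (suc i)) a)

  primitive-of-coprime-entries : ∀ {m} (u : Fin (suc m) → ℤ) a b → Coprime (u a) (u b) → Primitive u
  primitive-of-coprime-entries u a b (α , β , e) = cong +_ (ℕD.∣1⇒≡1 (ZDS.∣⇒∣ᵤ g∣1))
    where
    g∣1 : gcdVec u ZDS.∣ + 1
    g∣1 = subst (gcdVec u ZDS.∣_) e
            (ZDS.∣m∣n⇒∣m+n (ZDS.∣n⇒∣m*n α (ZDS.∣ᵤ⇒∣ (gcdVec∣entry u a)))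
                           (ZDS.∣n⇒∣m*n β (ZDS.∣ᵤ⇒∣ (gcdVec∣entry u b))))

  ∸-suc : ∀ {m n} → m ℕ.< n → n ∸ m ≡ suc (n ∸ suc m)
  ∸-suc h = ℕP.+-∸-assoc 1 h

  ≤ᵇ-true : ∀ {m n} → m ℕ.≤ n → (m ℕ.≤ᵇ n) ≡ true
  ≤ᵇ-true {m} {n} h = dec-true (T? (m ℕ.≤ᵇ n)) (ℕP.≤⇒≤ᵇ h)

  ≤ᵇ-false : ∀ {m n} → n ℕ.< m → (m ℕ.≤ᵇ n) ≡ false
  ≤ᵇ-false {m} {n} h = dec-false (T? (m ℕ.≤ᵇ n)) (λ t → ℕP.<⇒≱ h (ℕP.≤ᵇ⇒≤ m n t))

  ind≡ℤ : ℕ → ℕ → ℤ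
  ind≡ℤ zero    zero    = + 1
  ind≡ℤ zero    (suc k) = + 0
  ind≡ℤ (suc m) zero    = + 0
  ind≡ℤ (suc m) (suc k) = ind≡ℤ m k

  ind≡ℤ-refl : ∀ m → ind≡ℤ m m ≡ + 1
  ind≡ℤ-refl zero    = refl
  ind≡ℤ-refl (suc m) = ind≡ℤ-refl m

  ind≡ℤ-ne : ∀ {m k} → ¬ m ≡ k → ind≡ℤ m k ≡ + 0
  ind≡ℤ-ne {zero}  {zero}  ne = ⊥-elim (ne refl)
  ind≡ℤ-ne {zero}  {suc k} ne = refl
  ind≡ℤ-ne {suc m} {zero}  ne = refl
  ind≡ℤ-ne {suc m} {suc k} ne = ind≡ℤ-ne (λ e → ne (cong suc e))

  ι-ind≡ℤ : ∀ m j → ι (ind≡ℤ m j) ≡ ind≡ m j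
  ι-ind≡ℤ zero    zero    = refl
  ι-ind≡ℤ zero    (suc j) = refl
  ι-ind≡ℤ (suc m) zero    = refl
  ι-ind≡ℤ (suc m) (suc j) = ι-ind≡ℤ m j

  module Chain (r : ℕ) (P Q k : ℤ) (coprimePQ : Coprime P Q) where

    V : ℕ → ℤ
    V j = P ^ (r ∸ j) ℤ.* Q ^ j

    V-step : ∀ j → j ℕ.< r → P ℤ.* V (suc j) ≡ Q ℤ.* V j
    V-step j h rewrite ∸-suc h =
      solve 4 (λ P Q e f → P :* (e :* (Q :* f)) := Q :* ((P :* e) :* f)) refl P Q (P ^ (r ∸ suc j)) (Q ^ j)

    -- Given α P^(r-d) + β Q^(d+1) = 1, the sequence
    --   c ↦ -β Q^c P^(d-c)            for c ≤ d,
    --   c ↦  α Q^(c-d-1) P^(r-c)      for c > d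
    -- solves P X(c+1) - Q X(c) = [d = c].
    bezoutSolution : ℤ → ℤ → ℕ → ℕ → ℤ
    bezoutSolution α β d c =
      if c ℕ.≤ᵇ d then (ℤ.- β) ℤ.* (Q ^ c ℤ.* P ^ (d ∸ c)) else α ℤ.* (Q ^ (c ∸ suc d) ℤ.* P ^ (r ∸ c))

    bezoutSolution-step : ∀ α β d → α ℤ.* P ^ (r ∸ d) ℤ.+ β ℤ.* Q ^ suc d ≡ + 1 →
      ∀ j → j ℕ.< r → P ℤ.* bezoutSolution α β d (suc j) ℤ.- Q ℤ.* bezoutSolution α β d j ≡ ind≡ℤ d j
    bezoutSolution-step α β d bez j j<r with ℕP.<-cmp j d
    ... | tri< j<d _ _
      rewrite ≤ᵇ-true {suc j} {d} j<d | ≤ᵇ-true {j} {d} (ℕP.<⇒≤ j<d) | ∸-suc j<d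
            | ind≡ℤ-ne {d} {j} (λ e → ℕP.<⇒≢ j<d (sym e)) =
      solve 5 (λ P Q b qj e → P :* ((:- b) :* ((Q :* qj) :* e)) :- Q :* ((:- b) :* (qj :* (P :* e))) := con (+ 0))
              refl P Q β (Q ^ j) (P ^ (d ∸ suc j))
    ... | tri≈ _ refl _
      rewrite ≤ᵇ-false {suc d} {d} (ℕP.n<1+n d) | ≤ᵇ-true {d} {d} ℕP.≤-refl | ℕP.n∸n≡0 d | ind≡ℤ-refl d =
      trans (solve 6 (λ P Q a b e qd → P :* (a :* (con (+ 1) :* e)) :- Q :* ((:- b) :* (qd :* con (+ 1)))
                                       := a :* (P :* e) :+ b :* (Q :* qd))
                     refl P Q α β (P ^ (r ∸ suc d)) (Q ^ d))
            (trans (cong (λ t → α ℤ.* t ℤ.+ β ℤ.* (Q ℤ.* Q ^ d)) (cong (P ^_) (sym (∸-suc j<r)))) bez)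
    ... | tri> _ _ d<j
      rewrite ≤ᵇ-false {suc j} {d} (ℕP.<-trans d<j (ℕP.n<1+n j)) | ≤ᵇ-false {j} {d} d<j | ∸-suc d<j
            | ∸-suc j<r | ind≡ℤ-ne {d} {j} (λ e → ℕP.<⇒≢ d<j e) =
      solve 5 (λ P Q a qe pe → P :* (a :* ((Q :* qe) :* pe)) :- Q :* (a :* (qe :* (P :* pe))) := con (+ 0))
              refl P Q α (Q ^ (j ∸ suc d)) (P ^ (r ∸ suc j))

    bezout : ∀ d → Coprime (P ^ (r ∸ d)) (Q ^ suc d)
    bezout d = coprime-^ coprimePQ (r ∸ d) (suc d)

    solution : ℕ → ℕ → ℤ
    solution d = bezoutSolution (proj₁ (bezout d)) (proj₁ (proj₂ (bezout d))) d

    solution-step : ∀ d j → j ℕ.< r → P ℤ.* solution d (suc j) ℤ.- Q ℤ.* solution d j ≡ ind≡ℤ d j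
    solution-step d = bezoutSolution-step (proj₁ (bezout d)) (proj₁ (proj₂ (bezout d))) d (proj₂ (proj₂ (bezout d)))

    tailSum : (ℕ → ℤ) → ℤ
    tailSum U = sumℤ {r} (λ d → U (suc (toℕ d)))

    extend : (ℕ → ℤ) → Fin (suc (suc r)) → ℤ
    extend U zero    = + 2 ℤ.* tailSum U ℤ.- + 2 ℤ.* k ℤ.* U 0
    extend U (suc c) = U (toℕ c)

    v : Fin (suc (suc r)) → ℤ
    v = extend V

    e₀ : Fin (suc (suc r)) → ℤ
    e₀ zero    = + 1
    e₀ (suc _) = + 0

    lift : Fin (suc r) → Fin (suc (suc r)) → ℤ
    lift zero    = e₀
    lift (suc d) = extend (solution (toℕ d))

    -- v is primitive because its entries v_1 = P^r and v_(r+1) = Q^r are coprime.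
    v-primitive : Primitive v
    v-primitive = primitive-of-coprime-entries v (suc zero) (suc (Fin.fromℕ r))
                    (subst₂ Coprime (sym v₁≡Pʳ) (sym vₗₐₛₜ≡Qʳ) (coprime-^ coprimePQ r r))
      where
      v₁≡Pʳ : v (suc zero) ≡ P ^ r
      v₁≡Pʳ = ℤP.*-identityʳ (P ^ r)
      vₗₐₛₜ≡Qʳ : v (suc (Fin.fromℕ r)) ≡ Q ^ r
      vₗₐₛₜ≡Qʳ rewrite FinP.toℕ-fromℕ r | ℕP.n∸n≡0 r = ℤP.*-identityˡ (Q ^ r)

open CoprimeChain

module ErrorConstants (r : ℕ) where

  N : ℚ
  N = ℕ→ℚ (suc r)

  -- Entry bounds for Gram(a) and for R = Gram(s) (see GramSplitting).
  α ρ : ℚ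
  α = N * (1ℚ * 1ℚ)
  ρ = ℕ→ℚ (suc (suc r)) * (two * two)

  α≥0 : 0ℚ ≤ α
  α≥0 = mul≥0 (ℕ→ℚ≥0 (suc r)) (ℚP.≤ᵇ⇒≤ tt)

  ρ≥0 : 0ℚ ≤ ρ
  ρ≥0 = mul≥0 (ℕ→ℚ≥0 (suc (suc r))) (ℚP.≤ᵇ⇒≤ tt)

  -- How large k² must be for the perturbation lemma, and what it then gives.
  threshold E : ℚ
  threshold = ℕ→ℚ 2 * (N * N * N) * α * ρ
  E         = ℕ→ℚ 2 * (N * N * N) * α * α * ρ

  -- ‖v‖² ≤ Cᵥ k^(2n) (see NormBounds).
  Cᵥ : ℚ
  Cᵥ = ℕ→ℚ (suc (suc r)) * ((two * N * powℚ two r) * (two * N * powℚ two r))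

  Cᵥ≥0 : 0ℚ ≤ Cᵥ
  Cᵥ≥0 = mul≥0 (ℕ→ℚ≥0 (suc (suc r))) (sq≥0 (two * N * powℚ two r))

module Construction (r : ℕ) (P Q k : ℤ) (coprimePQ : Coprime P Q)
    (P≡k+1 : ι P ≡ ι k + 1ℚ) (Q≡k-1 : ι Q ≡ ι k - 1ℚ) (k≥1 : 1ℚ ≤ ι k) where
  open Chain r P Q k coprimePQ public
  open ErrorConstants r public
  open ℚSolver.+-*-Solver

  p q κ : ℚ
  p = ι P
  q = ι Q
  κ = ι k

  p>0 : 0ℚ < p
  p>0 = ℚP.<-≤-trans (ℚP.positive⁻¹ 1ℚ)
          (ℚP.≤-trans k≥1 (ℚP.≤-trans (ℚP.≤-reflexive (sym (ℚP.+-identityʳ κ)))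
            (ℚP.≤-trans (ℚP.+-monoʳ-≤ κ 0≤1) (ℚP.≤-reflexive (sym P≡k+1)))))

  tailℚ : Vecℚ (suc (suc r)) → ℚ
  tailℚ u = sumℚ {r} (λ d → u (suc (suc d)))

  ι-extend₀ : ∀ U → ι (extend U zero) ≡ two * tailℚ (toℚ (extend U)) - two * κ * ι (U 0)
  ι-extend₀ U = trans (ι-- (+ 2 ℤ.* tailSum U) (+ 2 ℤ.* k ℤ.* U 0))
    (cong₂ _-_ (trans (ι-* (+ 2) (tailSum U)) (cong (two *_) (ι-sum {r} (λ d → U (suc (toℕ d))))))
               (trans (ι-* (+ 2 ℤ.* k) (U 0)) (cong (_* ι (U 0)) (ι-* (+ 2) k))))

  module ProjectedBasis where

    f : Fin (suc r) → Vecℚ (suc (suc r))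
    f zero    zero          = 1ℚ
    f zero    (suc zero)    = two * κ
    f zero    (suc (suc d)) = ℚ.- two
    f (suc d) a             = p * δ (suc (suc d)) a - q * δ (suc (inject₁ d)) a

    dot-f₀ : ∀ u → dot (f zero) u ≡ u zero + two * κ * u (suc zero) - two * tailℚ u
    dot-f₀ u =
      trans (cong (λ t → 1ℚ * u zero + (two * κ * u (suc zero) + t)) (sum-*l {r} (ℚ.- two) (λ d → u (suc (suc d)))))
            (solve 5 (λ a t k b T → con 1ℚ :* a :+ (t :* k :* b :+ (:- t) :* T) := a :+ t :* k :* b :- t :* T)
                     refl (u zero) two κ (u (suc zero)) (tailℚ u))

    dot-fₛ : ∀ u d → dot (f (suc d)) u ≡ p * u (suc (suc d)) - q * u (suc (inject₁ d))
    dot-fₛ u d =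
      trans (sum-cong {suc (suc r)} (λ a → solve 5 (λ p x q y z → (p :* x :- q :* y) :* z := p :* (x :* z) :- q :* (y :* z))
                                                   refl p (δ (suc (suc d)) a) q (δ (suc (inject₁ d)) a) (u a)))
      (trans (sum-- {suc (suc r)} (λ a → p * (δ (suc (suc d)) a * u a)) (λ a → q * (δ (suc (inject₁ d)) a * u a)))
      (cong₂ _-_ (trans (sum-*l {suc (suc r)} p (λ a → δ (suc (suc d)) a * u a)) (cong (p *_) (sum-δ (suc (suc d)) u)))
                 (trans (sum-*l {suc (suc r)} q (λ a → δ (suc (inject₁ d)) a * u a)) (cong (q *_) (sum-δ (suc (inject₁ d)) u)))))

    f₀⊥extend : ∀ U → dot (f zero) (toℚ (extend U)) ≡ 0ℚ
    f₀⊥extend U = trans (dot-f₀ (toℚ (extend U)))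
      (trans (cong (λ t → t + two * κ * ι (U 0) - two * tailℚ (toℚ (extend U))) (ι-extend₀ U))
        (solve 4 (λ t T k u → t :* T :- t :* k :* u :+ t :* k :* u :- t :* T := con 0ℚ)
                 refl two (tailℚ (toℚ (extend U))) κ (ι (U 0))))

    dot-fₛ-extend : ∀ U d → dot (f (suc d)) (toℚ (extend U)) ≡ ι (P ℤ.* U (suc (toℕ d)) ℤ.- Q ℤ.* U (toℕ d))
    dot-fₛ-extend U d = trans (dot-fₛ (toℚ (extend U)) d)
      (trans (cong (λ t → p * ι (U (suc (toℕ d))) - q * ι (U t)) (FinP.toℕ-inject₁ d))
      (trans (cong₂ _-_ (sym (ι-* P (U (suc (toℕ d))))) (sym (ι-* Q (U (toℕ d)))))
             (sym (ι-- (P ℤ.* U (suc (toℕ d))) (Q ℤ.* U (toℕ d))))))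

    f⊥v : ∀ l → dot (f l) (toℚ v) ≡ 0ℚ
    f⊥v zero    = f₀⊥extend V
    f⊥v (suc d) = trans (dot-fₛ-extend V d)
      (cong ι (trans (cong (ℤ._- Q ℤ.* V (toℕ d)) (V-step (toℕ d) (FinP.toℕ<n d)))
                     (ℤP.+-inverseʳ (Q ℤ.* V (toℕ d)))))

    f·lift : ∀ l i → dot (f l) (toℚ (lift i)) ≡ δ l i
    f·lift zero zero = trans (dot-f₀ (toℚ e₀))
      (trans (cong (λ t → 1ℚ + two * κ * 0ℚ - two * t) (sum-0 {r}))
      (trans (solve 2 (λ t k → con 1ℚ :+ t :* k :* con 0ℚ :- t :* con 0ℚ := con 1ℚ) refl two κ)
             (sym (δ-refl {suc r} zero))))
    f·lift zero (suc d) = trans (f₀⊥extend (solution (toℕ d))) (sym (δ-ne {i = zero} {j = suc d} (λ ())))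
    f·lift (suc d') zero = trans (dot-fₛ (toℚ e₀) d')
      (trans (solve 2 (λ p q → p :* con 0ℚ :- q :* con 0ℚ := con 0ℚ) refl p q) (sym (δ-ne {i = suc d'} {j = zero} (λ ()))))
    f·lift (suc d') (suc d) = trans (dot-fₛ-extend (solution (toℕ d)) d')
      (trans (cong ι (solution-step (toℕ d) (toℕ d') (FinP.toℕ<n d')))
      (trans (ι-ind≡ℤ (toℕ d) (toℕ d'))
      (trans (ind≡-sym (toℕ d) (toℕ d')) (sym (trans (δ-suc d' d) (δ≡ind≡ d' d))))))

    -- V_0 = P^r > 0 is an entry of v, so ‖v‖² > 0.
    V₀ : ℚ
    V₀ = ι (V 0)

    V₀>0 : 0ℚ < V₀
    V₀>0 = ℚP.<-≤-trans (pow-pos p>0 r)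
             (ℚP.≤-reflexive (sym (trans (ι-* (P ^ r) (+ 1)) (trans (ℚP.*-identityʳ (ι (P ^ r))) (ι-pow P r)))))

    ‖v‖² : ℚ
    ‖v‖² = dot (toℚ v) (toℚ v)

    ‖v‖²>0 : 0ℚ < ‖v‖²
    ‖v‖²>0 = ℚP.<-≤-trans (ℚP.≤-<-trans (ℚP.≤-reflexive (sym (ℚP.*-zeroˡ V₀))) (ℚP.*-monoˡ-<-pos V₀ {{ℚ.positive V₀>0}} V₀>0))
                          (sum-≥-term {suc (suc r)} {λ a → toℚ v a * toℚ v a} (λ a → sq≥0 (toℚ v a)) (suc zero))

    -- A vector d orthogonal to all f_l is proportional to v (the recurrence
    -- p d_(c+1) = q d_c forces d_(c+1) ∝ V_c, and f_0 fixes d_0); if it is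
    -- also orthogonal to v it vanishes.
    module Annihilator (d : Vecℚ (suc (suc r))) (d⊥f : ∀ l → dot (f l) d ≡ 0ℚ) where
      d₁ : ℚ
      d₁ = d (suc zero)

      proportional-tail : ∀ m (c : Fin (suc r)) → toℕ c ≡ m → V₀ * d (suc c) ≡ d₁ * ι (V m)
      proportional-tail zero    zero    refl = ℚP.*-comm V₀ d₁
      proportional-tail (suc m) (suc c) e = cancelL p>0 (begin
          p * (V₀ * d (suc (suc c)))
        ≡⟨ solve 3 (λ p v x → p :* (v :* x) := v :* (p :* x)) refl p V₀ (d (suc (suc c))) ⟩
          V₀ * (p * d (suc (suc c)))
        ≡⟨ cong (V₀ *_) recurrence ⟩
          V₀ * (q * d (suc (inject₁ c)))
        ≡⟨ solve 3 (λ q v x → v :* (q :* x) := q :* (v :* x)) refl q V₀ (d (suc (inject₁ c))) ⟩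
          q * (V₀ * d (suc (inject₁ c)))
        ≡⟨ cong (q *_) (proportional-tail m (inject₁ c) (trans (FinP.toℕ-inject₁ c) (ℕP.suc-injective e))) ⟩
          q * (d₁ * ι (V m))
        ≡⟨ solve 3 (λ q a v → q :* (a :* v) := a :* (q :* v)) refl q d₁ (ι (V m)) ⟩
          d₁ * (q * ι (V m))
        ≡⟨ cong (d₁ *_) (sym V-stepℚ) ⟩
          d₁ * (p * ι (V (suc m)))
        ≡⟨ solve 3 (λ p a v → a :* (p :* v) := p :* (a :* v)) refl p d₁ (ι (V (suc m))) ⟩
          p * (d₁ * ι (V (suc m))) ∎)
        where
        open ≡-Reasoning
        recurrence : p * d (suc (suc c)) ≡ q * d (suc (inject₁ c))
        recurrence = trans (solve 2 (λ a b → a := (a :- b) :+ b) refl (p * d (suc (suc c))) (q * d (suc (inject₁ c))))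
                     (trans (cong (_+ q * d (suc (inject₁ c))) (trans (sym (dot-fₛ d c)) (d⊥f (suc c))))
                            (ℚP.+-identityˡ (q * d (suc (inject₁ c)))))
        V-stepℚ : p * ι (V (suc m)) ≡ q * ι (V m)
        V-stepℚ = trans (sym (ι-* P (V (suc m))))
                        (trans (cong ι (V-step m (subst (ℕ._< r) (ℕP.suc-injective e) (FinP.toℕ<n c)))) (ι-* Q (V m)))

      proportional : ∀ a → V₀ * d a ≡ d₁ * ι (v a)
      proportional (suc c) = proportional-tail (toℕ c) c refl
      proportional zero = begin
          V₀ * d zero
        ≡⟨ cong (V₀ *_) d₀≡ ⟩
          V₀ * (two * tailℚ d - two * κ * d₁)
        ≡⟨ solve 5 (λ v t T k a → v :* (t :* T :- t :* k :* a) := t :* (v :* T) :- t :* k :* (v :* a))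
                   refl V₀ two (tailℚ d) κ d₁ ⟩
          two * (V₀ * tailℚ d) - two * κ * (V₀ * d₁)
        ≡⟨ cong₂ (λ x y → two * x - two * κ * y) tail≡ (ℚP.*-comm V₀ d₁) ⟩
          two * (d₁ * tailℚ (toℚ v)) - two * κ * (d₁ * V₀)
        ≡⟨ solve 5 (λ t a T k v → t :* (a :* T) :- t :* k :* (a :* v) := a :* (t :* T :- t :* k :* v))
                   refl two d₁ (tailℚ (toℚ v)) κ V₀ ⟩
          d₁ * (two * tailℚ (toℚ v) - two * κ * V₀)
        ≡⟨ cong (d₁ *_) (sym (ι-extend₀ V)) ⟩
          d₁ * ι (v zero) ∎
        where
        open ≡-Reasoning
        d₀≡ : d zero ≡ two * tailℚ d - two * κ * d₁
        d₀≡ = trans (solve 4 (λ a t k b → a := (a :+ t :* k :* b) :- t :* k :* b) refl (d zero) two κ d₁)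
              (cong (_- two * κ * d₁)
                (trans (solve 2 (λ x tT → x := (x :- tT) :+ tT) refl (d zero + two * κ * d₁) (two * tailℚ d))
                  (trans (cong (_+ two * tailℚ d) (trans (sym (dot-f₀ d)) (d⊥f zero))) (ℚP.+-identityˡ (two * tailℚ d)))))
        tail≡ : V₀ * tailℚ d ≡ d₁ * tailℚ (toℚ v)
        tail≡ = trans (sym (sum-*l {r} V₀ (λ c → d (suc (suc c)))))
                (trans (sum-cong {r} (λ c → proportional-tail (suc (toℕ c)) (suc c) refl))
                       (sum-*l {r} d₁ (λ c → ι (V (suc (toℕ c))))))

      annihilated⇒zero : dot (toℚ v) d ≡ 0ℚ → ∀ a → d a ≡ 0ℚ
      annihilated⇒zero v⊥d a = cancel0 V₀>0 (trans (proportional a) (trans (cong (_* ι (v a)) d₁≡0) (ℚP.*-zeroˡ (ι (v a)))))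
        where
        V₀[v·d] : V₀ * dot (toℚ v) d ≡ ‖v‖² * d₁
        V₀[v·d] = trans (sym (sum-*l {suc (suc r)} V₀ (λ a → toℚ v a * d a)))
             (trans (sum-cong {suc (suc r)} (λ a →
                       trans (solve 3 (λ w x y → w :* (x :* y) := x :* (w :* y)) refl V₀ (toℚ v a) (d a))
                       (trans (cong (toℚ v a *_) (proportional a))
                              (solve 3 (λ x a w → x :* (a :* w) := x :* w :* a) refl (toℚ v a) d₁ (ι (v a))))))
             (sum-*r {suc (suc r)} d₁ (λ a → toℚ v a * toℚ v a)))
        d₁≡0 : d₁ ≡ 0ℚ
        d₁≡0 = cancel0 ‖v‖²>0 (trans (sym V₀[v·d]) (trans (cong (V₀ *_) v⊥d) (ℚP.*-zeroʳ V₀)))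

    open Annihilator using (annihilated⇒zero)

    projCoeff : Fin (suc r) → ℚ
    projCoeff i = dot (toℚ (lift i)) (toℚ v) * (1/ ‖v‖²) {{nonZero ‖v‖²>0}}

    y : Fin (suc r) → Vecℚ (suc (suc r))
    y i a = toℚ (lift i) a - projCoeff i * toℚ v a

    y⊥v : ∀ i → dot (y i) (toℚ v) ≡ 0ℚ
    y⊥v i = trans (dot-sym (y i) (toℚ v)) (trans (dot-lin (toℚ v) (toℚ (lift i)) (toℚ v) (projCoeff i))
      (trans (cong (λ t → t - projCoeff i * ‖v‖²) (dot-sym (toℚ v) (toℚ (lift i))))
      (trans (solve 3 (λ X iN N → X :- X :* iN :* N := X :- X :* (iN :* N)) refl x·v ((1/ ‖v‖²) {{nonZero ‖v‖²>0}}) ‖v‖²)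
      (trans (cong (λ t → x·v - x·v * t) (ℚP.*-inverseˡ ‖v‖² {{nonZero ‖v‖²>0}}))
             (solve 1 (λ X → X :- X :* con 1ℚ := con 0ℚ) refl x·v)))))
      where
      x·v : ℚ
      x·v = dot (toℚ (lift i)) (toℚ v)

    f·y : ∀ l i → dot (f l) (y i) ≡ δ l i
    f·y l i = trans (dot-lin (f l) (toℚ (lift i)) (toℚ v) (projCoeff i))
      (trans (cong₂ (λ a b → a - projCoeff i * b) (f·lift l i) (f⊥v l))
             (solve 2 (λ a t → a :- t :* con 0ℚ := a) refl (δ l i) (projCoeff i)))

    expand-in-y : ∀ (z : Vecℚ (suc (suc r))) (c : Fin (suc r) → ℚ) →
      dot (toℚ v) z ≡ 0ℚ → (∀ l → dot (f l) z ≡ c l) → ∀ a → z a ≡ lincomb c y a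
    expand-in-y z c v⊥z fz≡c a =
      trans (solve 2 (λ a b → a := (a :- b) :+ b) refl (z a) (lincomb c y a))
      (trans (cong (_+ lincomb c y a) (annihilated⇒zero residual residual⊥f residual⊥v a)) (ℚP.+-identityˡ _))
      where
      residual : Vecℚ (suc (suc r))
      residual a = z a - lincomb c y a
      residual⊥f : ∀ l → dot (f l) residual ≡ 0ℚ
      residual⊥f l = trans (dot-sub (f l) z (lincomb c y))
        (trans (cong₂ _-_ (fz≡c l) (trans (dot-lincomb (f l) c y)
                  (trans (sum-cong {suc r} (λ i → cong (c i *_) (f·y l i))) (sum-δᵗ c l))))
               (ℚP.+-inverseʳ (c l)))
      residual⊥v : dot (toℚ v) residual ≡ 0ℚ
      residual⊥v = trans (dot-sub (toℚ v) z (lincomb c y))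
        (trans (cong₂ _-_ v⊥z (trans (dot-lincomb (toℚ v) c y)
                  (trans (sum-cong {suc r} (λ i → trans (cong (c i *_) (trans (dot-sym (toℚ v) (y i)) (y⊥v i)))
                                                        (ℚP.*-zeroʳ (c i))))
                         (sum-0 {suc r}))))
               (ℚP.+-inverseʳ 0ℚ))

    fℤ : Fin (suc r) → (Fin (suc (suc r)) → ℤ) → ℤ
    fℤ zero    x = x zero ℤ.+ + 2 ℤ.* k ℤ.* x (suc zero) ℤ.- + 2 ℤ.* sumℤ {r} (λ d → x (suc (suc d)))
    fℤ (suc d) x = P ℤ.* x (suc (suc d)) ℤ.- Q ℤ.* x (suc (inject₁ d))

    ι-fℤ : ∀ l x → ι (fℤ l x) ≡ dot (f l) (toℚ x)
    ι-fℤ zero x =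
      trans (ι-- (x zero ℤ.+ + 2 ℤ.* k ℤ.* x (suc zero)) (+ 2 ℤ.* sumℤ {r} (λ d → x (suc (suc d)))))
      (trans (cong₂ _-_ (trans (ι-+ (x zero) (+ 2 ℤ.* k ℤ.* x (suc zero)))
                               (cong (λ t → ι (x zero) + t) (trans (ι-* (+ 2 ℤ.* k) (x (suc zero)))
                                                                  (cong (_* ι (x (suc zero))) (ι-* (+ 2) k)))))
                        (trans (ι-* (+ 2) (sumℤ {r} (λ d → x (suc (suc d)))))
                               (cong (two *_) (ι-sum {r} (λ d → x (suc (suc d)))))))
             (sym (dot-f₀ (toℚ x))))
    ι-fℤ (suc d) x = trans (ι-- (P ℤ.* x (suc (suc d))) (Q ℤ.* x (suc (inject₁ d))))
      (trans (cong₂ _-_ (ι-* P (x (suc (suc d)))) (ι-* Q (x (suc (inject₁ d))))) (sym (dot-fₛ (toℚ x) d)))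

    y∈Λ : ∀ i → ProjLattice v (y i)
    y∈Λ i = lift i , y⊥v i , projCoeff i ,
            λ a → solve 3 (λ x t w → x :- (x :- t :* w) := t :* w) refl (toℚ (lift i) a) (projCoeff i) (toℚ v a)

    y-independent : ∀ (c : Fin (suc r) → ℚ) → (∀ j → lincomb c y j ≡ 0ℚ) → ∀ i → c i ≡ 0ℚ
    y-independent c h i = begin
        c i
      ≡⟨ sym (sum-δᵗ c i) ⟩
        sumℚ (λ l → c l * δ i l)
      ≡⟨ sum-cong {suc r} (λ l → cong (c l *_) (sym (f·y i l))) ⟩
        sumℚ (λ l → c l * dot (f i) (y l))
      ≡⟨ sym (dot-lincomb (f i) c y) ⟩
        dot (f i) (lincomb c y)
      ≡⟨ trans (sum-cong {suc (suc r)} (λ a → trans (cong (f i a *_) (h a)) (ℚP.*-zeroʳ (f i a)))) (sum-0 {suc (suc r)}) ⟩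
        0ℚ ∎
      where open ≡-Reasoning

    -- The projection of x ∈ ℤ^(r+2) is Σ_l (f_l · x) y_l, with f_l · x ∈ ℤ.
    y-spans : ∀ z → ProjLattice v z → ∃ λ (c : Fin (suc r) → ℤ) → ∀ j → z j ≡ lincomb (toℚ c) y j
    y-spans z (x , z⊥v , t , x-z≡tv) =
      (λ l → fℤ l x) , expand-in-y z (λ l → ι (fℤ l x)) (trans (dot-sym (toℚ v) z) z⊥v) pairing
      where
      z≡x-tv : ∀ a → z a ≡ toℚ x a - t * toℚ v a
      z≡x-tv a = trans (solve 3 (λ z x tv → z := x :- (x :- z)) refl (z a) (toℚ x a) (t * toℚ v a))
                       (cong (toℚ x a -_) (x-z≡tv a))
      pairing : ∀ l → dot (f l) z ≡ ι (fℤ l x)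
      pairing l = trans (sum-cong {suc (suc r)} (λ a → cong (f l a *_) (z≡x-tv a)))
        (trans (dot-lin (f l) (toℚ x) (toℚ v) t)
        (trans (cong₂ (λ a b → a - t * b) (sym (ι-fℤ l x)) (f⊥v l))
               (solve 2 (λ a t → a :- t :* con 0ℚ := a) refl (ι (fℤ l x)) t)))

    y-isBasis : IsBasis (ProjLattice v) y
    y-isBasis = y∈Λ , y-independent , y-spans

    -- Gram matrices of (f_l) and (y_i); since f_m = Σ_i (f_m · f_i) y_i, HG = I.
    H G : Fin (suc r) → Fin (suc r) → ℚ
    H m j = dot (f m) (f j)
    G i j = dot (y i) (y j)

    f-expansion : ∀ m a → f m a ≡ lincomb (H m) y a
    f-expansion m = expand-in-y (f m) (H m) (trans (dot-sym (toℚ v) (f m)) (f⊥v m)) (λ l → dot-sym (f l) (f m))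

    HG≡I : ∀ m i → sumℚ (λ j → H m j * G j i) ≡ δ m i
    HG≡I m i = begin
        sumℚ (λ j → H m j * sumℚ (λ a → y j a * y i a))
      ≡⟨ sum-cong {suc r} (λ j → sym (sum-*l {suc (suc r)} (H m j) (λ a → y j a * y i a))) ⟩
        sumℚ (λ j → sumℚ (λ a → H m j * (y j a * y i a)))
      ≡⟨ sum-swap {suc r} {suc (suc r)} (λ j a → H m j * (y j a * y i a)) ⟩
        sumℚ (λ a → sumℚ (λ j → H m j * (y j a * y i a)))
      ≡⟨ sum-cong {suc (suc r)} (λ a → trans (sum-cong {suc r} (λ j → sym (ℚP.*-assoc (H m j) (y j a) (y i a))))
                                     (trans (sum-*r {suc r} (y i a) (λ j → H m j * y j a))
                                            (cong (_* y i a) (sym (f-expansion m a))))) ⟩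
        dot (f m) (y i)
      ≡⟨ f·y m i ⟩
        δ m i ∎
      where open ≡-Reasoning

  open ProjectedBasis public

  -- f_m = k b̃_m + s_m with b̃_m = (0, b_m) and s_m = rest m a bounded integer
  -- vector.  The cross terms S m j = b̃_m · s_j are antisymmetric in (m, j),
  -- so H = k² M + R with M = Gram(b) and R = Gram(s).
  module GramSplitting where

    b̃ : Fin (suc r) → Vecℚ (suc (suc r))
    b̃ m zero    = 0ℚ
    b̃ m (suc c) = dnBasis m c

    rest : Fin (suc r) → Vecℚ (suc (suc r))
    rest zero    zero          = 1ℚ
    rest zero    (suc zero)    = 0ℚ
    rest zero    (suc (suc d)) = ℚ.- two
    rest (suc d) zero          = 0ℚ
    rest (suc d) (suc c)       = δ (suc d) c + δ (inject₁ d) c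

    f-split : ∀ m a → f m a ≡ κ * b̃ m a + rest m a
    f-split zero zero = solve 1 (λ k → con 1ℚ := k :* con 0ℚ :+ con 1ℚ) refl κ
    f-split zero (suc zero) =
      trans (solve 2 (λ t k → t :* k := k :* (t :* con 1ℚ) :+ con 0ℚ) refl two κ)
            (cong (λ x → κ * (two * x) + 0ℚ) (sym (δ-refl {suc r} zero)))
    f-split zero (suc (suc d)) =
      trans (solve 2 (λ t k → :- t := k :* (t :* con 0ℚ) :+ (:- t)) refl two κ)
            (cong (λ x → κ * (two * x) + ℚ.- two) (sym (δ-ne {i = zero} {j = suc d} (λ ()))))
    f-split (suc d) zero =
      trans (cong₂ (λ x z → p * x - q * z) (δ-ne {i = suc (suc d)} {j = zero} (λ ())) (δ-ne {i = suc (inject₁ d)} {j = zero} (λ ())))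
            (solve 3 (λ p q k → p :* con 0ℚ :- q :* con 0ℚ := k :* con 0ℚ :+ con 0ℚ) refl p q κ)
    f-split (suc d) (suc c) =
      trans (cong₂ (λ x z → p * x - q * z) (δ-suc (suc d) c) (δ-suc (inject₁ d) c))
      (trans (cong₂ (λ p' q' → p' * δ (suc d) c - q' * δ (inject₁ d) c) P≡k+1 Q≡k-1)
             (solve 3 (λ k x z → (k :+ con 1ℚ) :* x :- (k :- con 1ℚ) :* z := k :* (x :- z) :+ (x :+ z))
                      refl κ (δ (suc d) c) (δ (inject₁ d) c)))

    K : ℚ
    K = κ * κ

    M R : Fin (suc r) → Fin (suc r) → ℚ
    M m j = dot (dnBasis m) (dnBasis j)
    R m j = dot (rest m) (rest j)

    dot-b̃ : ∀ m (u : Vecℚ (suc (suc r))) → dot (b̃ m) u ≡ dot (λ c → u (suc c)) (dnBasis m)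
    dot-b̃ m u = trans (cong (_+ dot (dnBasis m) (λ c → u (suc c))) (ℚP.*-zeroˡ (u zero)))
                      (trans (ℚP.+-identityˡ _) (dot-sym (dnBasis m) (λ c → u (suc c))))

    S : Fin (suc r) → Fin (suc r) → ℚ
    S m j = dot (b̃ m) (rest j)

    S₀ : ∀ j → S zero j ≡ two * rest j (suc zero)
    S₀ j = trans (dot-b̃ zero (rest j)) (dot-b₀ (λ c → rest j (suc c)))

    Sₛ : ∀ d j → S (suc d) j ≡ rest j (suc (suc d)) - rest j (suc (inject₁ d))
    Sₛ d j = trans (dot-b̃ (suc d) (rest j)) (dot-bₛ (λ c → rest j (suc c)) d)

    S-antisym₀ : ∀ j → S zero j + S j zero ≡ 0ℚ
    S-antisym₀ zero = trans (cong₂ _+_ (S₀ zero) (S₀ zero)) (solve 1 (λ t → t :* con 0ℚ :+ t :* con 0ℚ := con 0ℚ) refl two)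
    S-antisym₀ (suc zero) = trans (cong₂ _+_ (S₀ (suc zero)) (Sₛ zero zero))
      (trans (cong (λ x → two * (δ {suc r} (suc zero) zero + x) + (ℚ.- two - 0ℚ)) (δ-refl {suc r} zero))
      (trans (cong (λ x → two * (x + 1ℚ) + (ℚ.- two - 0ℚ)) (δ-ne {suc r} {i = suc zero} {j = zero} (λ ())))
             (solve 1 (λ t → t :* (con 0ℚ :+ con 1ℚ) :+ (:- t :- con 0ℚ) := con 0ℚ) refl two)))
    S-antisym₀ (suc (suc d)) = trans (cong₂ _+_ (S₀ (suc (suc d))) (Sₛ (suc d) zero))
      (trans (cong₂ (λ x z → two * (x + z) + (ℚ.- two - ℚ.- two))
                    (δ-ne {i = suc (suc d)} {j = zero} (λ ())) (δ-ne {i = suc (inject₁ d)} {j = zero} (λ ())))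
             (solve 1 (λ t → t :* (con 0ℚ :+ con 0ℚ) :+ (:- t :- (:- t)) := con 0ℚ) refl two))

    S-antisym : ∀ m j → S m j + S j m ≡ 0ℚ
    S-antisym zero    j    = S-antisym₀ j
    S-antisym (suc d) zero = trans (ℚP.+-comm (S (suc d) zero) (S zero (suc d))) (S-antisym₀ (suc d))
    S-antisym (suc d) (suc d') = trans (cong₂ _+_ (Sₛ d (suc d')) (Sₛ d' (suc d)))
      (trans (cong₂ _+_ (cong₂ _-_ (cong₂ _+_ (δss d' d) (δis d' d)) (cong₂ _+_ (δsi d' d) (δii d' d)))
                        (cong₂ _-_ (cong₂ _+_ (δss d d') (δis d d')) (cong₂ _+_ (δsi d d') (δii d d'))))
             (cancels (toℕ d) (toℕ d')))
      where
      δss : ∀ (a b : Fin r) → δ (suc a) (suc b) ≡ ind≡ (toℕ a) (toℕ b)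
      δss a b = trans (δ-suc a b) (δ≡ind≡ a b)
      δis : ∀ (a b : Fin r) → δ (inject₁ a) (suc b) ≡ ind≡ (toℕ a) (suc (toℕ b))
      δis a b = trans (δ≡ind≡ (inject₁ a) (suc b)) (cong (λ t → ind≡ t (suc (toℕ b))) (FinP.toℕ-inject₁ a))
      δsi : ∀ (a b : Fin r) → δ (suc a) (inject₁ b) ≡ ind≡ (suc (toℕ a)) (toℕ b)
      δsi a b = trans (δ≡ind≡ (suc a) (inject₁ b)) (cong (ind≡ (suc (toℕ a))) (FinP.toℕ-inject₁ b))
      δii : ∀ (a b : Fin r) → δ (inject₁ a) (inject₁ b) ≡ ind≡ (toℕ a) (toℕ b)
      δii a b = trans (δ≡ind≡ (inject₁ a) (inject₁ b)) (cong₂ ind≡ (FinP.toℕ-inject₁ a) (FinP.toℕ-inject₁ b))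
      cancels : ∀ a b → (ind≡ b a + ind≡ b (suc a) - (ind≡ (suc b) a + ind≡ b a))
                        + (ind≡ a b + ind≡ a (suc b) - (ind≡ (suc a) b + ind≡ a b)) ≡ 0ℚ
      cancels a b =
        trans (cong₂ (λ x z → (ind≡ b a + x - (ind≡ (suc b) a + ind≡ b a)) + (ind≡ a b + z - (ind≡ (suc a) b + ind≡ a b)))
                     (ind≡-sym b (suc a)) (ind≡-sym a (suc b)))
              (solve 4 (λ X Y A B → (X :+ A :- (B :+ X)) :+ (Y :+ B :- (A :+ Y)) := con 0ℚ) refl
                       (ind≡ b a) (ind≡ a b) (ind≡ (suc a) b) (ind≡ (suc b) a))

    H≡KM+R : ∀ m j → H m j ≡ K * M m j + R m j
    H≡KM+R m j = begin
        dot (f m) (f j)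
      ≡⟨ sum-cong {suc (suc r)} (λ a → cong₂ _*_ (f-split m a) (f-split j a)) ⟩
        dot (λ a → κ * b̃ m a + rest m a) (λ a → κ * b̃ j a + rest j a)
      ≡⟨ dot-expand κ (b̃ m) (rest m) (b̃ j) (rest j) ⟩
        K * dot (b̃ m) (b̃ j) + κ * (S m j + dot (rest m) (b̃ j)) + R m j
      ≡⟨ cong₂ (λ x z → K * x + κ * (S m j + z) + R m j) b̃·b̃ (dot-sym (rest m) (b̃ j)) ⟩
        K * M m j + κ * (S m j + S j m) + R m j
      ≡⟨ cong (λ x → K * M m j + κ * x + R m j) (S-antisym m j) ⟩
        K * M m j + κ * 0ℚ + R m j
      ≡⟨ solve 3 (λ a k b → a :+ k :* con 0ℚ :+ b := a :+ b) refl (K * M m j) κ (R m j) ⟩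
        K * M m j + R m j ∎
      where
      open ≡-Reasoning
      b̃·b̃ : dot (b̃ m) (b̃ j) ≡ M m j
      b̃·b̃ = trans (cong (_+ M m j) (ℚP.*-zeroˡ 0ℚ)) (ℚP.+-identityˡ (M m j))

    rest-bound : ∀ m a → ∣ rest m a ∣ ≤ two
    rest-bound zero    zero          = ℚP.≤ᵇ⇒≤ tt
    rest-bound zero    (suc zero)    = ℚP.≤ᵇ⇒≤ tt
    rest-bound zero    (suc (suc d)) = ℚP.≤ᵇ⇒≤ tt
    rest-bound (suc d) zero          = ℚP.≤ᵇ⇒≤ tt
    rest-bound (suc d) (suc c)       = sum-of-bits (δ-01 (suc d) c) (δ-01 (inject₁ d) c)
      where
      sum-of-bits : ∀ {x z : ℚ} → (x ≡ 0ℚ ⊎ x ≡ 1ℚ) → (z ≡ 0ℚ ⊎ z ≡ 1ℚ) → ∣ x + z ∣ ≤ two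
      sum-of-bits (inj₁ refl) (inj₁ refl) = ℚP.≤ᵇ⇒≤ tt
      sum-of-bits (inj₁ refl) (inj₂ refl) = ℚP.≤ᵇ⇒≤ tt
      sum-of-bits (inj₂ refl) (inj₁ refl) = ℚP.≤ᵇ⇒≤ tt
      sum-of-bits (inj₂ refl) (inj₂ refl) = ℚP.≤ᵇ⇒≤ tt

    dualBasis-bound : ∀ (i c : Fin (suc r)) → ∣ dualBasis i c ∣ ≤ 1ℚ
    dualBasis-bound zero c = ℚP.≤ᵇ⇒≤ tt
    dualBasis-bound (suc d) c with ind<-01 (toℕ d) (toℕ c)
    ... | inj₁ e = subst (λ t → ∣ t ∣ ≤ 1ℚ) (sym e) (ℚP.≤ᵇ⇒≤ tt)
    ... | inj₂ e = subst (λ t → ∣ t ∣ ≤ 1ℚ) (sym e) (ℚP.≤ᵇ⇒≤ tt)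

    K|A-KG|≤E : threshold ≤ K →
                ∀ i j → K * ∣ gramDual i j - K * G i j ∣ ≤ E
    K|A-KG|≤E K-large =
      inverse-perturbation G H gramDual M R K α ρ HG≡I (gram-inverse {r}) H≡KM+R
        (λ i j → dot-bound (dualBasis i) (dualBasis j) 1ℚ 1ℚ (dualBasis-bound i) (dualBasis-bound j))
        (λ m j → dot-bound (rest m) (rest j) two two (rest-bound m) (rest-bound j))
        ρ≥0 (sq≥0 κ) α≥0 K-large

  open GramSplitting public

  -- Size of v: every entry is at most 2n 2^r κ^n, so ‖v‖² = O(k^(2n)).
  -- Combined with the perturbation bound this gives the error estimate.
  module NormBounds where

    κ≥0 : 0ℚ ≤ κ
    κ≥0 = ℚP.≤-trans 0≤1 k≥1

    q≥0 : 0ℚ ≤ q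
    q≥0 = ℚP.≤-trans (ℚP.≤-reflexive (sym (ℚP.+-inverseʳ 1ℚ)))
            (ℚP.≤-trans (ℚP.+-monoˡ-≤ (ℚ.- 1ℚ) k≥1) (ℚP.≤-reflexive (sym Q≡k-1)))

    q≤p : q ≤ p
    q≤p = ℚP.≤-trans (ℚP.≤-reflexive Q≡k-1)
            (ℚP.≤-trans (ℚP.+-monoʳ-≤ κ (ℚP.≤ᵇ⇒≤ tt)) (ℚP.≤-reflexive (sym P≡k+1)))

    p≥0 : 0ℚ ≤ p
    p≥0 = ℚP.≤-trans q≥0 q≤p

    p≤2κ : p ≤ two * κ
    p≤2κ = ℚP.≤-trans (ℚP.≤-reflexive P≡k+1)
             (ℚP.≤-trans (ℚP.+-monoʳ-≤ κ k≥1) (ℚP.≤-reflexive (solve 1 (λ k → k :+ k := con two :* k) refl κ)))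

    B : ℚ
    B = two * N * powℚ two r * powℚ κ (suc r)

    ι-V : ∀ j → ι (V j) ≡ powℚ p (r ∸ j) * powℚ q j
    ι-V j = trans (ι-* (P ^ (r ∸ j)) (Q ^ j)) (cong₂ _*_ (ι-pow P (r ∸ j)) (ι-pow Q j))

    V≥0 : ∀ j → 0ℚ ≤ ι (V j)
    V≥0 j = ℚP.≤-trans (mul≥0 (pow-nonneg p≥0 (r ∸ j)) (pow-nonneg q≥0 j)) (ℚP.≤-reflexive (sym (ι-V j)))

    -- Since q ≤ p, every V_j is at most p^r ≤ (2κ)^r.
    V≤pʳ : ∀ j → j ℕ.≤ r → ι (V j) ≤ powℚ p r
    V≤pʳ j h = ℚP.≤-trans (ℚP.≤-reflexive (ι-V j))
      (ℚP.≤-trans (mulL (pow-nonneg p≥0 (r ∸ j)) (pow-mono q≥0 q≤p j))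
        (ℚP.≤-reflexive (trans (sym (pow-+ p (r ∸ j) j)) (cong (powℚ p) (ℕP.m∸n+n≡m h)))))

    pʳ≤ : powℚ p r ≤ powℚ two r * powℚ κ r
    pʳ≤ = ℚP.≤-trans (pow-mono p≥0 p≤2κ r) (ℚP.≤-reflexive (pow-* two κ r))

    2N≥1 : 1ℚ ≤ two * N
    2N≥1 = ℚP.≤-trans (ℚP.≤ᵇ⇒≤ {1ℚ} {two * 1ℚ} tt) (mulL {two} two≥0 (ℕ→ℚ-mono {1} {suc r} (ℕ.s≤s ℕ.z≤n)))

    2ʳκʳ≤B : powℚ two r * powℚ κ r ≤ B
    2ʳκʳ≤B = ℚP.≤-trans (mulL (pow-nonneg two≥0 r) (le-mul1 k≥1 (pow-nonneg κ≥0 r)))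
      (ℚP.≤-trans (le-mul1 2N≥1 (mul≥0 (pow-nonneg two≥0 r) (mul≥0 κ≥0 (pow-nonneg κ≥0 r))))
        (ℚP.≤-reflexive (solve 3 (λ a t k → a :* (t :* k) := a :* t :* k) refl (two * N) (powℚ two r) (powℚ κ (suc r)))))

    r+κ≤Nκ : ℕ→ℚ r + κ ≤ N * κ
    r+κ≤Nκ = ℚP.≤-trans (ℚP.+-monoˡ-≤ κ (le-mul1 k≥1 (ℕ→ℚ≥0 r)))
      (ℚP.≤-reflexive (trans (cong (_+ κ) (ℚP.*-comm κ (ℕ→ℚ r)))
        (trans (solve 2 (λ R k → R :* k :+ k := (R :+ con 1ℚ) :* k) refl (ℕ→ℚ r) κ)
               (cong (_* κ) (sym (ℕ→ℚ-suc r))))))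

    entry-bound : ∀ a → ∣ toℚ v a ∣ ≤ B
    entry-bound (suc c) = ℚP.≤-trans (ℚP.≤-reflexive (ℚP.0≤p⇒∣p∣≡p (V≥0 (toℕ c))))
      (ℚP.≤-trans (V≤pʳ (toℕ c) (ℕP.≤-pred (FinP.toℕ<n c))) (ℚP.≤-trans pʳ≤ 2ʳκʳ≤B))
    entry-bound zero = begin
        ∣ toℚ v zero ∣
      ≡⟨ cong ∣_∣ (ι-extend₀ V) ⟩
        ∣ two * Tt - two * κ * V₀ ∣
      ≤⟨ ℚP.∣p-q∣≤∣p∣+∣q∣ (two * Tt) (two * κ * V₀) ⟩
        ∣ two * Tt ∣ + ∣ two * κ * V₀ ∣
      ≡⟨ cong₂ _+_ (ℚP.0≤p⇒∣p∣≡p (mul≥0 two≥0 Tt≥0)) (ℚP.0≤p⇒∣p∣≡p (mul≥0 (mul≥0 two≥0 κ≥0) (V≥0 0))) ⟩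
        two * Tt + two * κ * V₀
      ≤⟨ ℚP.+-mono-≤ (mulL {two} two≥0 Tt≤) (mulL {two * κ} (mul≥0 two≥0 κ≥0) (V≤pʳ 0 ℕ.z≤n)) ⟩
        two * (ℕ→ℚ r * powℚ p r) + two * κ * powℚ p r
      ≡⟨ solve 4 (λ t R x k → t :* (R :* x) :+ t :* k :* x := t :* (R :+ k) :* x) refl two (ℕ→ℚ r) (powℚ p r) κ ⟩
        two * (ℕ→ℚ r + κ) * powℚ p r
      ≤⟨ mulR (pow-nonneg p≥0 r) (mulL {two} two≥0 r+κ≤Nκ) ⟩
        two * (N * κ) * powℚ p r
      ≤⟨ mulL {two * (N * κ)} (mul≥0 two≥0 (mul≥0 (ℕ→ℚ≥0 (suc r)) κ≥0)) pʳ≤ ⟩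
        two * (N * κ) * (powℚ two r * powℚ κ r)
      ≡⟨ solve 5 (λ t N k T K → t :* (N :* k) :* (T :* K) := t :* N :* T :* (k :* K)) refl two N κ (powℚ two r) (powℚ κ r) ⟩
        B ∎
      where
      open ℚP.≤-Reasoning
      Tt : ℚ
      Tt = tailℚ (toℚ v)
      Tt≥0 : 0ℚ ≤ Tt
      Tt≥0 = sum-nonneg {r} (λ d → V≥0 (suc (toℕ d)))
      Tt≤ : Tt ≤ ℕ→ℚ r * powℚ p r
      Tt≤ = sum-bound {r} (powℚ p r) (λ d → V≤pʳ (suc (toℕ d)) (FinP.toℕ<n d))

    ‖v‖²≤ : ‖v‖² ≤ Cᵥ * powℚ K (suc r)
    ‖v‖²≤ = ℚP.≤-trans
      (sum-bound {suc (suc r)} (B * B) (λ a → ℚP.≤-trans (ℚP.≤-reflexive (sym (sq-abs (toℚ v a))))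
                                                       (mul-mono (ℚP.0≤∣p∣ _) (ℚP.0≤∣p∣ _) (entry-bound a) (entry-bound a))))
      (ℚP.≤-reflexive (trans (cong (ℕ→ℚ (suc (suc r)) *_) B²≡)
        (sym (ℚP.*-assoc (ℕ→ℚ (suc (suc r))) (two * N * powℚ two r * (two * N * powℚ two r)) (powℚ K (suc r))))))
      where
      B²≡ : B * B ≡ two * N * powℚ two r * (two * N * powℚ two r) * powℚ K (suc r)
      B²≡ = trans (solve 3 (λ a b c → a :* b :* (a :* c) := a :* a :* (b :* c)) refl
                           (two * N * powℚ two r) (powℚ κ (suc r)) (powℚ κ (suc r)))
                  (cong (two * N * powℚ two r * (two * N * powℚ two r) *_) (sym (pow-* κ κ (suc r))))

    -- |Gram(a) - K G|^n ‖v‖² ≤ Cᵥ (K |Gram(a) - K G|)^n ≤ Cᵥ E^n.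
    error-bound : threshold ≤ K →
      ∀ i j → powℚ ∣ gramDual i j - K * G i j ∣ (suc r) * ‖v‖² ≤ Cᵥ * powℚ E (suc r)
    error-bound K-large i j = begin
        powℚ e (suc r) * ‖v‖²
      ≤⟨ mulL (pow-nonneg (ℚP.0≤∣p∣ (gramDual i j - K * G i j)) (suc r)) ‖v‖²≤ ⟩
        powℚ e (suc r) * (Cᵥ * powℚ K (suc r))
      ≡⟨ solve 3 (λ a b c → a :* (b :* c) := b :* (a :* c)) refl (powℚ e (suc r)) Cᵥ (powℚ K (suc r)) ⟩
        Cᵥ * (powℚ e (suc r) * powℚ K (suc r))
      ≡⟨ cong (Cᵥ *_) (sym (pow-* e K (suc r))) ⟩
        Cᵥ * powℚ (e * K) (suc r)
      ≤⟨ mulL Cᵥ≥0 (pow-mono (mul≥0 (ℚP.0≤∣p∣ (gramDual i j - K * G i j)) (sq≥0 κ)) eK≤E (suc r)) ⟩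
        Cᵥ * powℚ E (suc r) ∎
      where
      open ℚP.≤-Reasoning
      e : ℚ
      e = ∣ gramDual i j - K * G i j ∣
      eK≤E : e * K ≤ E
      eK≤E = ℚP.≤-trans (ℚP.≤-reflexive (ℚP.*-comm e K)) (K|A-KG|≤E K-large i j)

  open NormBounds public

-- ‖v‖² ≥ k: for r = 0 the first entry of v is -2k, otherwise the entry
-- V_0 = P^r is at least P ≥ k.
module _ (P Q k : ℤ) (coprimePQ : Coprime P Q)
    (P≡k+1 : ι P ≡ ι k + 1ℚ) (Q≡k-1 : ι Q ≡ ι k - 1ℚ) (k≥1 : 1ℚ ≤ ι k) where
  open ℚSolver.+-*-Solver

  ‖v‖²≥k : ∀ r → ι k ≤ Construction.‖v‖² r P Q k coprimePQ P≡k+1 Q≡k-1 k≥1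
  ‖v‖²≥k zero =
    ℚP.≤-trans κ≤4κ² (ℚP.≤-trans (ℚP.≤-reflexive (sym v₀²≡4κ²))
                                 (sum-≥-term {2} (λ a → sq≥0 (toℚ v a)) zero))
    where
    open Construction zero P Q k coprimePQ P≡k+1 Q≡k-1 k≥1
    v₀²≡4κ² : toℚ v zero * toℚ v zero ≡ two * two * (κ * κ)
    v₀²≡4κ² = trans (cong₂ _*_ (ι-extend₀ V) (ι-extend₀ V))
      (solve 2 (λ t k → (t :* con 0ℚ :- t :* k :* con 1ℚ) :* (t :* con 0ℚ :- t :* k :* con 1ℚ) := t :* t :* (k :* k))
               refl two κ)
    κ≤4κ² : κ ≤ two * two * (κ * κ)
    κ≤4κ² = ℚP.≤-trans (le-mul1 k≥1 κ≥0) (le-mul1 {two * two} (ℚP.≤ᵇ⇒≤ tt) (mul≥0 κ≥0 κ≥0))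
  ‖v‖²≥k (suc r) =
    ℚP.≤-trans κ≤V₀ (ℚP.≤-trans (le-mul1 V₀≥1 (ℚP.≤-trans 0≤1 V₀≥1))
                                (sum-≥-term {suc (suc (suc r))} (λ a → sq≥0 (toℚ v a)) (suc zero)))
    where
    open Construction (suc r) P Q k coprimePQ P≡k+1 Q≡k-1 k≥1
    κ≤p : κ ≤ p
    κ≤p = ℚP.≤-trans (ℚP.≤-reflexive (sym (ℚP.+-identityʳ κ)))
            (ℚP.≤-trans (ℚP.+-monoʳ-≤ κ 0≤1) (ℚP.≤-reflexive (sym P≡k+1)))
    p≥1 : 1ℚ ≤ p
    p≥1 = ℚP.≤-trans k≥1 κ≤p
    V₀≡pʳ⁺¹ : V₀ ≡ p * powℚ p r
    V₀≡pʳ⁺¹ = trans (ι-* (P ^ suc r) (Q ^ 0)) (trans (ℚP.*-identityʳ (ι (P ^ suc r))) (ι-pow P (suc r)))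
    V₀≥1 : 1ℚ ≤ V₀
    V₀≥1 = ℚP.≤-trans (pow≥1 p≥1 (suc r)) (ℚP.≤-reflexive (sym V₀≡pʳ⁺¹))
    κ≤V₀ : κ ≤ V₀
    κ≤V₀ = ℚP.≤-trans κ≤p
             (ℚP.≤-trans (le-mul1 (pow≥1 p≥1 r) p≥0) (ℚP.≤-reflexive (trans (ℚP.*-comm (powℚ p r) p) (sym V₀≡pʳ⁺¹))))

module OddFamily where
  open ℚSolver.+-*-Solver

  kw Pw Qw : ℕ → ℤ
  kw w = + suc (suc (w ℕ.+ w))
  Pw w = + suc (suc (suc (w ℕ.+ w)))
  Qw w = + suc (w ℕ.+ w)

  Pw≡kw+1 : ∀ w → ι (Pw w) ≡ ι (kw w) + 1ℚ
  Pw≡kw+1 w = ℕ→ℚ-suc (suc (suc (w ℕ.+ w)))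

  Qw≡kw-1 : ∀ w → ι (Qw w) ≡ ι (kw w) - 1ℚ
  Qw≡kw-1 w = trans (solve 1 (λ x → x := x :+ con 1ℚ :- con 1ℚ) refl (ι (Qw w)))
                    (cong (_- 1ℚ) (sym (ℕ→ℚ-suc (suc (w ℕ.+ w)))))

  w≤kw : ∀ w → ℕ→ℚ w ≤ ι (kw w)
  w≤kw w = ℕ→ℚ-mono (ℕP.≤-trans (ℕP.m≤m+n w w) (ℕP.≤-trans (ℕP.n≤1+n _) (ℕP.n≤1+n _)))

  kw≥1 : ∀ w → 1ℚ ≤ ι (kw w)
  kw≥1 w = ℕ→ℚ-mono {1} {suc (suc (w ℕ.+ w))} (ℕ.s≤s ℕ.z≤n)

  module Family (r w : ℕ) =
    Construction r (Pw w) (Qw w) (kw w) (coprime-odd-neighbours w) (Pw≡kw+1 w) (Qw≡kw-1 w) (kw≥1 w)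

  -- ‖v_w‖² ≥ k_w ≥ w.
  normSq-unbounded : ∀ r (M : ℕ) → ∃ λ (W : ℕ) → ∀ w → w ≥ W → + M ℤ.≤ normSqℤ (Family.v r w)
  normSq-unbounded r M = M , λ w w≥M → ι-cancel-≤
    (ℚP.≤-trans (ℕ→ℚ-mono w≥M)
    (ℚP.≤-trans (w≤kw w)
    (ℚP.≤-trans (‖v‖²≥k (Pw w) (Qw w) (kw w) (coprime-odd-neighbours w) (Pw≡kw+1 w) (Qw≡kw-1 w) (kw≥1 w) r)
                (ℚP.≤-reflexive (sym (ι-normSq (Family.v r w)))))))

  -- The threshold of the perturbation lemma, as a natural number: once
  -- w ≥ Wₙ, we have k_w² ≥ k_w ≥ w ≥ threshold.
  Wₙ : ℕ → ℕ
  Wₙ r = 2 ℕ.* (n ℕ.* n ℕ.* n) ℕ.* (n ℕ.* 1) ℕ.* (suc n ℕ.* 4)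
    where
    n : ℕ
    n = suc r

  Wₙ≡threshold : ∀ r → ℕ→ℚ (Wₙ r) ≡ ErrorConstants.threshold r
  Wₙ≡threshold r =
    trans (ℕ→ℚ-* (2 ℕ.* (n ℕ.* n ℕ.* n) ℕ.* (n ℕ.* 1)) (suc n ℕ.* 4))
      (cong₂ _*_ (trans (ℕ→ℚ-* (2 ℕ.* (n ℕ.* n ℕ.* n)) (n ℕ.* 1))
                        (cong₂ _*_ (trans (ℕ→ℚ-* 2 (n ℕ.* n ℕ.* n))
                                          (cong (ℕ→ℚ 2 *_) (trans (ℕ→ℚ-* (n ℕ.* n) n) (cong (_* ℕ→ℚ n) (ℕ→ℚ-* n n)))))
                                   (ℕ→ℚ-* n 1)))
                 (ℕ→ℚ-* (suc n) 4))
    where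
    n : ℕ
    n = suc r

  K-large : ∀ r w → w ≥ Wₙ r → ErrorConstants.threshold r ≤ Family.K r w
  K-large r w w≥W =
    ℚP.≤-trans (ℚP.≤-reflexive (sym (Wₙ≡threshold r)))
      (ℚP.≤-trans (ℕ→ℚ-mono w≥W)
        (ℚP.≤-trans (w≤kw w) (le-mul1 (kw≥1 w) (ℚP.≤-trans 0≤1 (kw≥1 w)))))

open OddFamily

proposition3 : (n : ℕ) → n ≥ 1 →
    Σ (ℕ → (Fin (suc n) → ℤ)) λ v →
      (∀ w → Primitive (v w))
      × (∀ (M : ℕ) → ∃ λ (W : ℕ) → ∀ w → w ≥ W → + M ℤ.≤ normSqℤ (v w))
      × Σ (ℕ → Fin n → Fin n → ℚ) λ Aw →
          (∀ w → IsGramMatrix (ProjLattice (v w)) (Aw w))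
          × Σ (Fin n → Fin n → ℚ) λ A →
              IsGramMatrix (DnDual n) A
              × Σ (ℕ → ℚ) λ c →
                  ∃ λ (C : ℚ) → ∃ λ (W : ℕ) → ∀ w → w ≥ W → ∀ i j →
                    powℚ ∣ A i j - c w * Aw w i j ∣ n * (normSqℤ (v w) ℚ./ 1) ℚ.≤ C
proposition3 (suc r) _ =
  Family.v r , Family.v-primitive r , normSq-unbounded r ,
  Family.G r , (λ w → Family.y r w , Family.y-isBasis r w , λ i j → refl) ,
  gramDual , (dualBasis , dualBasis-isBasis , λ i j → refl) ,
  Family.K r , Cᵥ * powℚ E (suc r) , Wₙ r , error
  where
  open ErrorConstants r using (Cᵥ; E)
  error : ∀ w → w ≥ Wₙ r → ∀ i j →
    powℚ ∣ gramDual i j - Family.K r w * Family.G r w i j ∣ (suc r) * (normSqℤ (Family.v r w) ℚ./ 1)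
      ≤ Cᵥ * powℚ E (suc r)
  error w w≥W i j =
    subst (_≤ Cᵥ * powℚ E (suc r))
          (cong (powℚ ∣ gramDual i j - Family.K r w * Family.G r w i j ∣ (suc r) *_) (sym (ι-normSq (Family.v r w))))
          (Family.error-bound r w (K-large r w w≥W) i j)
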